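{- For $x\in\{\xi,\eta,\xi\eta\}$, the ideal $\Lambda(1-x)\subset\Lambda$ is a $G_{\mathbb{Q}}$-stable free cyclic $\Lambda$-module (i.e. $1-x$ is not a zero divisor in $\Lambda$ and $\sigma(\Lambda(1-x))=\Lambda(1-x)$ for all $\sigma\in G_{\mathbb{Q}}$).
   Context: $\mu_N\subset\mathbb{C}^\times$ is the group of $N$th roots of unity, $\zeta_N=e^{2\pi i/N}$, $\Delta_N=\mu_N\times\mu_N$, $\xi_N=(\zeta_N,1)$, $\eta_N=(1,\zeta_N)$; for $N\mid M$, $\Delta_M\to\Delta_N$ is $(\zeta,\zeta')\mapsto(\zeta^{M/N},\zeta'^{M/N})$; $\Delta_\infty=\varprojlim\Delta_N$ with $\xi=(\xi_N)_N$, $\eta=(\eta_N)_N$; $\Lambda=\widehat{\mathbb{Z}}[[\Delta_\infty]]=\varprojlim_N\widehat{\mathbb{Z}}[\Delta_N]$. $G_{\mathbb{Q}}=\mathrm{Gal}(\overline{\mathbb{Q}}/\mathbb{Q})$ acts on $\Delta_\infty$ by $g\mapsto g^{\mathrm{cyc}(\sigma)}$, where $\mathrm{cyc}\colon G_{\mathbb{Q}}\to\widehat{\mathbb{Z}}^\times$ is the cyclotomic character, and hence continuously on $\Lambda$ by ring automorphisms. (The parenthetical in the claim reads "$\Lambda(1-x)$ is free cyclic with basis $1-x$".) -}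

module Defs where

-- Concrete model of  Λ = Ẑ[[Δ∞]] = lim_N Ẑ[Δ_N],  Ẑ = lim_M ℤ/M,
-- with its G_ℚ-action through the cyclotomic character.
-- Conventions:
--  * levels are indexed by n : ℕ standing for N = suc n (N ≥ 1);
--  * μ_N is identified with Fin N via k ↦ ζ_N^k, so Δ_N = Fin N × Fin N,
--    ξ_N = (1 mod N , 0), η_N = (0 , 1 mod N);
--    the transition Δ_{N'} → Δ_N (N ∣ N'), ζ ↦ ζ^{N'/N}, becomes k ↦ k mod N;
--  * an element of Ẑ is a compatible family of integer representatives
--    r m of its residue mod (suc m), equality being congruence at every level.

open import Data.Nat as ℕ using (ℕ; zero; suc)
open import Data.Nat.DivMod using (_mod_)
import Data.Nat.Divisibility as ℕD
open import Data.Integer as ℤ using (ℤ; +_; 0ℤ; 1ℤ)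
open import Data.Integer.DivMod using (_%ℕ_)
open import Data.Integer.Divisibility using (_∣_)
open import Data.Fin as Fin using (Fin; toℕ)
open import Data.Bool using (Bool; true; false; if_then_else_; _∧_)
open import Relation.Nullary.Decidable using (⌊_⌋)
open import Data.Product using (Σ; _×_; ∃)

Cong : ℕ → ℤ → ℤ → Set
Cong M a b = (+ M) ∣ (a ℤ.- b)

sumFin : ∀ k → (Fin k → ℤ) → ℤ
sumFin zero    f = 0ℤ
sumFin (suc k) f = f Fin.zero ℤ.+ sumFin k (λ i → f (Fin.suc i))

RawẐ : Set
RawẐ = ℕ → ℤ

IsẐ : RawẐ → Set
IsẐ u = ∀ m m' → suc m ℕD.∣ suc m' → Cong (suc m) (u m') (u m)

-- units of Ẑ  (the image of the cyclotomic character  G_ℚ → Ẑ^×)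
IsUnitẐ : RawẐ → Set
IsUnitẐ u = IsẐ u × Σ RawẐ (λ v → IsẐ v × (∀ m → Cong (suc m) (u m ℤ.* v m) 1ℤ))

-- raw elements: coefficient of the group element (a , b) ∈ Δ_{suc n},
-- taken modulo (suc m)
Raw : Set
Raw = (n : ℕ) → Fin (suc n) → Fin (suc n) → ℕ → ℤ

push : ∀ {A B} → (Fin A → Fin B) → (Fin A → Fin A → ℤ) → Fin B → Fin B → ℤ
push {A} φ f b₁ b₂ =
  sumFin A (λ a₁ → sumFin A (λ a₂ →
    if ⌊ φ a₁ Fin.≟ b₁ ⌋ ∧ ⌊ φ a₂ Fin.≟ b₂ ⌋ then f a₁ a₂ else 0ℤ))

proj : ∀ {n'} n → Fin (suc n') → Fin (suc n)
proj n a = toℕ a mod suc n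

-- Λ = lim_N Ẑ[Δ_N]: each coefficient lies in Ẑ, and the family is
-- compatible under the transition maps Ẑ[Δ_{N'}] → Ẑ[Δ_N]
IsΛ : Raw → Set
IsΛ c =
  (∀ n a b m m' → suc m ℕD.∣ suc m' → Cong (suc m) (c n a b m') (c n a b m))
  × (∀ n n' → suc n ℕD.∣ suc n' → ∀ b₁ b₂ m →
       Cong (suc m) (push (proj n) (λ a₁ a₂ → c n' a₁ a₂ m) b₁ b₂) (c n b₁ b₂ m))

_≈Λ_ : Raw → Raw → Set
c ≈Λ d = ∀ n a b m → Cong (suc m) (c n a b m) (d n a b m)

subF : ∀ {N} → Fin (suc N) → Fin (suc N) → Fin (suc N)
subF {N} c a = (toℕ c ℕ.+ (suc N ℕ.∸ toℕ a)) mod suc N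

_*Λ_ : Raw → Raw → Raw
(c *Λ d) n b₁ b₂ m =
  sumFin (suc n) (λ a₁ → sumFin (suc n) (λ a₂ →
    c n a₁ a₂ m ℤ.* d n (subF b₁ a₁) (subF b₂ a₂) m))

_-Λ_ : Raw → Raw → Raw
(c -Λ d) n a b m = c n a b m ℤ.- d n a b m

0Λ : Raw
0Λ _ _ _ _ = 0ℤ

-- the group element (ζ_N^e₁ , ζ_N^e₂)_N of Δ∞ as an element of Λ
pt : ℕ → ℕ → Raw
pt e₁ e₂ n a b _ =
  if ⌊ a Fin.≟ (e₁ mod suc n) ⌋ ∧ ⌊ b Fin.≟ (e₂ mod suc n) ⌋ then 1ℤ else 0ℤ

1Λ ξ η ξη : Raw
1Λ = pt 0 0
ξ  = pt 1 0
η  = pt 0 1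
ξη = pt 1 1

-- action of u ∈ Ẑ^× (σ with cyc(σ) = u) on Δ_N : g ↦ g^u
scale : RawẐ → (n : ℕ) → Fin (suc n) → Fin (suc n)
scale u n a = (toℕ a ℕ.* (u n %ℕ suc n)) mod suc n

act : RawẐ → Raw → Raw
act u c n b₁ b₂ m = push (scale u n) (λ a₁ a₂ → c n a₁ a₂ m) b₁ b₂

data Which : Set where
  isξ isη isξη : Which

elt : Which → Raw
elt isξ  = ξ
elt isη  = η
elt isξη = ξη

module Submission where

-- If l (1 - x) = 0, every coefficient function of l is invariant under translation by x.
-- By compatibility of levels, the coefficient of l at a point of Δ_N is, modulo m + 1, the
-- sum of the (m + 1)² coefficients at level N (m + 1) lying over it.  As one coordinate of x
-- is a generator, translation invariance gives the m + 1 rows of this grid equal sums, so the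
-- total vanishes modulo m + 1 and l = 0.  For stability, σ(x) = x^e with e = cyc(σ), hence
-- σ(l (1 - x)) = σ(l) (1 + x + ⋯ + x^(e-1)) (1 - x); at each level and coefficient index only
-- e modulo N (m + 1) matters, which makes the cofactor an element of Λ.  Applying this to σ⁻¹
-- gives the reverse inclusion.

open import Defs
open import Data.Bool using (Bool; true; false; if_then_else_; _∧_)
open import Data.Empty using (⊥-elim)
open import Data.Fin as Fin using (Fin; toℕ)
import Data.Fin.Properties as FinP
open import Data.Integer as ℤ using (ℤ; +_; 0ℤ; 1ℤ)
  renaming (_+_ to _+ᶻ_; _*_ to _*ᶻ_; _-_ to _-ᶻ_; -_ to -ᶻ_)
open import Data.Integer.DivMod using (_%ℕ_; _/ℕ_; a≡a%ℕn+[a/ℕn]*n)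
import Data.Integer.Divisibility.Signed as ℤD
import Data.Integer.Properties as ℤP
open import Data.Integer.Tactic.RingSolver using (solve-∀)
open import Data.Nat using (ℕ; zero; suc; _+_; _*_; _∸_)
open import Data.Nat.DivMod using (_%_; _mod_; _/_)
import Data.Nat.DivMod as ℕDM
import Data.Nat.Divisibility as ℕD
import Data.Nat.Properties as ℕP
import Data.Nat.Tactic.RingSolver as ℕSolver
open import Data.Product using (Σ; _×_; _,_; proj₁; proj₂)
open import Data.Sum using (inj₁; inj₂)
open import Relation.Binary.Bundles using (Setoid)
import Relation.Binary.Reasoning.Setoid as SetoidReasoning
open import Relation.Binary.PropositionalEquality
open import Relation.Nullary.Decidable using (⌊_⌋; Dec; yes; no)

-- Congruences

-- Congruence of integers, wrapped in a record so that the modulus and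
-- both sides can be inferred from the type.
infix 4 _≋[_]_
record _≋[_]_ (a : ℤ) (M : ℕ) (b : ℤ) : Set where
  constructor mk≋
  field divides-diff : + M ℤD.∣ (a -ᶻ b)

private
  ≋-via : ∀ {M x y} → x ≡ y → + M ℤD.∣ x → + M ℤD.∣ y
  ≋-via {M} = subst (+ M ℤD.∣_)

≋-refl : ∀ {M a} → a ≋[ M ] a
≋-refl {M} {a} = mk≋ (≋-via (sym (ℤP.+-inverseʳ a)) (ℤD.divides 0ℤ (sym (ℤP.*-zeroˡ (+ M)))))

≡⇒≋ : ∀ {M a b} → a ≡ b → a ≋[ M ] b
≡⇒≋ refl = ≋-refl

≋-sym : ∀ {M a b} → a ≋[ M ] b → b ≋[ M ] a
≋-sym {a = a} {b} (mk≋ p) = mk≋ (≋-via (identity a b) (ℤD.∣m⇒∣-m p))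
  where identity : ∀ a b → -ᶻ (a -ᶻ b) ≡ b -ᶻ a
        identity = solve-∀

≋-trans : ∀ {M a b c} → a ≋[ M ] b → b ≋[ M ] c → a ≋[ M ] c
≋-trans {a = a} {b} {c} (mk≋ p) (mk≋ q) = mk≋ (≋-via (identity a b c) (ℤD.∣m∣n⇒∣m+n p q))
  where identity : ∀ a b c → (a -ᶻ b) +ᶻ (b -ᶻ c) ≡ a -ᶻ c
        identity = solve-∀

≋-setoid : ℕ → Setoid _ _
≋-setoid M = record
  { Carrier = ℤ ; _≈_ = _≋[ M ]_
  ; isEquivalence = record { refl = ≋-refl ; sym = ≋-sym ; trans = ≋-trans } }

module ≋-Reasoning (M : ℕ) = SetoidReasoning (≋-setoid M)

≋-+ : ∀ {M a b c d} → a ≋[ M ] b → c ≋[ M ] d → (a +ᶻ c) ≋[ M ] (b +ᶻ d)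
≋-+ {a = a} {b} {c} {d} (mk≋ p) (mk≋ q) = mk≋ (≋-via (identity a b c d) (ℤD.∣m∣n⇒∣m+n p q))
  where identity : ∀ a b c d → (a -ᶻ b) +ᶻ (c -ᶻ d) ≡ (a +ᶻ c) -ᶻ (b +ᶻ d)
        identity = solve-∀

≋-*ˡ : ∀ {M a b} c → a ≋[ M ] b → (c *ᶻ a) ≋[ M ] (c *ᶻ b)
≋-*ˡ {a = a} {b} c (mk≋ p) = mk≋ (≋-via (identity a b c) (ℤD.∣n⇒∣m*n c p))
  where identity : ∀ a b c → c *ᶻ (a -ᶻ b) ≡ c *ᶻ a -ᶻ c *ᶻ b
        identity = solve-∀

≋-* : ∀ {M a a' b b'} → a ≋[ M ] a' → b ≋[ M ] b' → (a *ᶻ b) ≋[ M ] (a' *ᶻ b')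
≋-* {a = a} {a'} {b} {b'} p q = ≋-trans (≋-*ˡ a q)
  (≋-trans (≡⇒≋ (ℤP.*-comm a b')) (≋-trans (≋-*ˡ b' p) (≡⇒≋ (ℤP.*-comm b' a'))))

M*x≋0 : ∀ {M} x → (+ M *ᶻ x) ≋[ M ] 0ℤ
M*x≋0 {M} x = mk≋ (ℤD.divides x (identity (+ M) x))
  where identity : ∀ m x → m *ᶻ x -ᶻ 0ℤ ≡ x *ᶻ m
        identity = solve-∀

≋-weaken : ∀ {M M' a b} → M ℕD.∣ M' → a ≋[ M' ] b → a ≋[ M ] b
≋-weaken M∣M' (mk≋ p) = mk≋ (ℤD.∣-trans (ℤD.∣ᵤ⇒∣ M∣M') p)

a-b≋0⇒a≋b : ∀ {M a b} → (a -ᶻ b) ≋[ M ] 0ℤ → a ≋[ M ] b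
a-b≋0⇒a≋b {a = a} {b} (mk≋ p) = mk≋ (≋-via (ℤP.+-identityʳ (a -ᶻ b)) p)

Cong⇒≋ : ∀ {M a b} → Cong M a b → a ≋[ M ] b
Cong⇒≋ p = mk≋ (ℤD.∣ᵤ⇒∣ p)

≋⇒Cong : ∀ {M a b} → a ≋[ M ] b → Cong M a b
≋⇒Cong (mk≋ p) = ℤD.∣⇒∣ᵤ p

%ℕ-≋ : ∀ a K → + (a %ℕ suc K) ≋[ suc K ] a
%ℕ-≋ a K = begin
  + (a %ℕ suc K)
    ≡⟨ ℤP.+-identityʳ _ ⟨
  + (a %ℕ suc K) +ᶻ 0ℤ
    ≈⟨ ≋-+ (≋-refl {a = + (a %ℕ suc K)}) (M*x≋0 (a /ℕ suc K)) ⟨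
  + (a %ℕ suc K) +ᶻ + suc K *ᶻ (a /ℕ suc K)
    ≡⟨ cong (+ (a %ℕ suc K) +ᶻ_) (ℤP.*-comm (+ suc K) (a /ℕ suc K)) ⟩
  + (a %ℕ suc K) +ᶻ (a /ℕ suc K) *ᶻ + suc K
    ≡⟨ a≡a%ℕn+[a/ℕn]*n a (suc K) ⟨
  a
    ∎
  where open ≋-Reasoning (suc K)

-- x ≡[ n ] y is congruence modulo suc n, matching the indexing of levels in Defs.
infix 4 _≡[_]_
record _≡[_]_ (x n y : ℕ) : Set where
  constructor mk≡
  field %-equal : x % suc n ≡ y % suc n

mod-refl : ∀ {n x} → x ≡[ n ] x
mod-refl = mk≡ refl

≡⇒mod : ∀ {n x y} → x ≡ y → x ≡[ n ] y
≡⇒mod refl = mod-refl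

mod-sym : ∀ {n x y} → x ≡[ n ] y → y ≡[ n ] x
mod-sym (mk≡ p) = mk≡ (sym p)

mod-trans : ∀ {n x y z} → x ≡[ n ] y → y ≡[ n ] z → x ≡[ n ] z
mod-trans (mk≡ p) (mk≡ q) = mk≡ (trans p q)

mod-setoid : ℕ → Setoid _ _
mod-setoid n = record
  { Carrier = ℕ ; _≈_ = _≡[ n ]_
  ; isEquivalence = record { refl = mod-refl ; sym = mod-sym ; trans = mod-trans } }

module mod-Reasoning (n : ℕ) = SetoidReasoning (mod-setoid n)

mod-+ : ∀ {n x y x' y'} → x ≡[ n ] x' → y ≡[ n ] y' → x + y ≡[ n ] x' + y'
mod-+ {n} {x} {y} {x'} {y'} (mk≡ p) (mk≡ q) = mk≡ (begin
  (x + y) % suc n                    ≡⟨ ℕDM.%-distribˡ-+ x y (suc n) ⟩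
  (x % suc n + y % suc n) % suc n    ≡⟨ cong₂ (λ a b → (a + b) % suc n) p q ⟩
  (x' % suc n + y' % suc n) % suc n  ≡⟨ ℕDM.%-distribˡ-+ x' y' (suc n) ⟨
  (x' + y') % suc n                  ∎)
  where open ≡-Reasoning

mod-* : ∀ {n x y x' y'} → x ≡[ n ] x' → y ≡[ n ] y' → x * y ≡[ n ] x' * y'
mod-* {n} {x} {y} {x'} {y'} (mk≡ p) (mk≡ q) = mk≡ (begin
  (x * y) % suc n                      ≡⟨ ℕDM.%-distribˡ-* x y (suc n) ⟩
  (x % suc n * (y % suc n)) % suc n    ≡⟨ cong₂ (λ a b → (a * b) % suc n) p q ⟩
  (x' % suc n * (y' % suc n)) % suc n  ≡⟨ ℕDM.%-distribˡ-* x' y' (suc n) ⟨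
  (x' * y') % suc n                    ∎)
  where open ≡-Reasoning

mod-+ʳ : ∀ {n x y} z → x ≡[ n ] y → x + z ≡[ n ] y + z
mod-+ʳ z p = mod-+ p (mod-refl {x = z})

mod-+ˡ : ∀ {n y z} x → y ≡[ n ] z → x + y ≡[ n ] x + z
mod-+ˡ x p = mod-+ (mod-refl {x = x}) p

mod-*ˡ : ∀ {n y z} x → y ≡[ n ] z → x * y ≡[ n ] x * z
mod-*ˡ x p = mod-* (mod-refl {x = x}) p

mod-*ʳ : ∀ {n x y} z → x ≡[ n ] y → x * z ≡[ n ] y * z
mod-*ʳ z p = mod-* p (mod-refl {x = z})

%-mod : ∀ {n} x → x % suc n ≡[ n ] x
%-mod {n} x = mk≡ (ℕDM.m%n%n≡m%n x (suc n))

+-*N-mod : ∀ {n} x k → x + k * suc n ≡[ n ] x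
+-*N-mod {n} x k = mk≡ (ℕDM.[m+kn]%n≡m%n x k (suc n))

N-mod : ∀ {n} → suc n ≡[ n ] 0
N-mod {n} = mk≡ (ℕDM.n%n≡0 (suc n))

N*-mod : ∀ {n} x → suc n * x ≡[ n ] 0
N*-mod {n} x = mk≡ (trans (cong (_% suc n) (ℕP.*-comm (suc n) x)) (ℕDM.m*n%n≡0 x (suc n)))

+-N*-mod : ∀ {n} x y → x + suc n * y ≡[ n ] x
+-N*-mod x y = mod-trans (mod-+ˡ x (N*-mod y)) (≡⇒mod (ℕP.+-identityʳ x))

mod-weaken : ∀ {n n' x y} → suc n ℕD.∣ suc n' → x ≡[ n' ] y → x ≡[ n ] y
mod-weaken {n} {n'} {x} {y} n∣n' (mk≡ p) = mk≡ (begin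
  x % suc n            ≡⟨ ℕDM.m∣n⇒o%n%m≡o%m (suc n) (suc n') x n∣n' ⟨
  x % suc n' % suc n   ≡⟨ cong (_% suc n) p ⟩
  y % suc n' % suc n   ≡⟨ ℕDM.m∣n⇒o%n%m≡o%m (suc n) (suc n') y n∣n' ⟩
  y % suc n            ∎)
  where open ≡-Reasoning

mod-cancelʳ-+ : ∀ {n x y} z → x + z ≡[ n ] y + z → x ≡[ n ] y
mod-cancelʳ-+ {n} {x} {y} z p = begin
  x                    ≈⟨ +-N*-mod x z ⟨
  x + suc n * z        ≡⟨ ℕP.+-assoc x z (n * z) ⟨
  x + z + n * z        ≈⟨ mod-+ʳ (n * z) p ⟩
  y + z + n * z        ≡⟨ ℕP.+-assoc y z (n * z) ⟩
  y + suc n * z        ≈⟨ +-N*-mod y z ⟩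
  y                    ∎
  where open mod-Reasoning n

+≋+⇒mod : ∀ {n} x y → + x ≋[ suc n ] + y → x ≡[ n ] y
+≋+⇒mod {n} x y (mk≋ p) with ℕP.≤-total x y
... | inj₁ x≤y = mk≡ (sym (begin
  y % suc n              ≡⟨ cong (_% suc n) (ℕP.m+[n∸m]≡n x≤y) ⟨
  (x + (y ∸ x)) % suc n  ≡⟨ ℕDM.%-remove-+ʳ x (subst (suc n ℕD.∣_) ∣x-y∣ (ℤD.∣⇒∣ᵤ p)) ⟩
  x % suc n              ∎))
  where open ≡-Reasoning
        ∣x-y∣ : ℤ.∣ + x -ᶻ + y ∣ ≡ y ∸ x
        ∣x-y∣ = trans (cong ℤ.∣_∣ (ℤP.m-n≡m⊖n x y)) (ℤP.∣⊖∣-≤ x≤y)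
... | inj₂ y≤x = mk≡ (begin
  x % suc n              ≡⟨ cong (_% suc n) (ℕP.m+[n∸m]≡n y≤x) ⟨
  (y + (x ∸ y)) % suc n  ≡⟨ ℕDM.%-remove-+ʳ y (subst (suc n ℕD.∣_) ∣x-y∣ (ℤD.∣⇒∣ᵤ p)) ⟩
  y % suc n              ∎)
  where open ≡-Reasoning
        ∣x-y∣ : ℤ.∣ + x -ᶻ + y ∣ ≡ x ∸ y
        ∣x-y∣ = trans (cong ℤ.∣_∣ (ℤP.m-n≡m⊖n x y)) (trans (ℤP.∣m⊖n∣≡∣n⊖m∣ x y) (ℤP.∣⊖∣-≤ y≤x))

toℕ-mod : ∀ n x → toℕ (x mod suc n) ≡[ n ] x
toℕ-mod n x = mod-trans (≡⇒mod (FinP.toℕ-fromℕ< _)) (%-mod x)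

toℕ-injective-mod : ∀ {n} {a b : Fin (suc n)} → toℕ a ≡[ n ] toℕ b → a ≡ b
toℕ-injective-mod {a = a} {b} (mk≡ p) =
  FinP.toℕ-injective (trans (sym (ℕDM.m<n⇒m%n≡m (FinP.toℕ<n a))) (trans p (ℕDM.m<n⇒m%n≡m (FinP.toℕ<n b))))

mod-cong : ∀ {n x y} → x ≡[ n ] y → x mod suc n ≡ y mod suc n
mod-cong {n} {x} {y} p = toℕ-injective-mod (mod-trans (toℕ-mod n x) (mod-trans p (mod-sym (toℕ-mod n y))))

toℕ-mod-id : ∀ {n} (a : Fin (suc n)) → toℕ a mod suc n ≡ a
toℕ-mod-id {n} a = toℕ-injective-mod (toℕ-mod n (toℕ a))

infixl 6 _⊕_ _⊖_
_⊕_ : ∀ {n} → Fin (suc n) → ℕ → Fin (suc n)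
_⊕_ {n} a t = (toℕ a + t) mod suc n

-- n * d is - d modulo suc n.
_⊖_ : ∀ {n} → Fin (suc n) → ℕ → Fin (suc n)
_⊖_ {n} a d = a ⊕ n * d

toℕ-⊕ : ∀ {n} (a : Fin (suc n)) t → toℕ (a ⊕ t) ≡[ n ] toℕ a + t
toℕ-⊕ {n} a t = toℕ-mod n (toℕ a + t)

mod-⊕ : ∀ n x t → (x mod suc n) ⊕ t ≡ (x + t) mod suc n
mod-⊕ n x t = mod-cong (mod-+ʳ t (toℕ-mod n x))

⊕-assoc : ∀ {n} (a : Fin (suc n)) s t → a ⊕ s ⊕ t ≡ a ⊕ (s + t)
⊕-assoc {n} a s t = trans (mod-⊕ n (toℕ a + s) t) (mod-cong (≡⇒mod (ℕP.+-assoc (toℕ a) s t)))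

⊕-congˡ : ∀ {n} (a : Fin (suc n)) {s t} → s ≡[ n ] t → a ⊕ s ≡ a ⊕ t
⊕-congˡ a p = mod-cong (mod-+ˡ (toℕ a) p)

⊕-identityʳ : ∀ {n} (a : Fin (suc n)) → a ⊕ 0 ≡ a
⊕-identityʳ a = trans (mod-cong (≡⇒mod (ℕP.+-identityʳ (toℕ a)))) (toℕ-mod-id a)

⊕-cancelʳ : ∀ {n} {a b : Fin (suc n)} s → a ⊕ s ≡ b ⊕ s → a ≡ b
⊕-cancelʳ {n} {a} {b} s p = toℕ-injective-mod (mod-cancelʳ-+ s (begin
  toℕ a + s       ≈⟨ toℕ-⊕ a s ⟨
  toℕ (a ⊕ s)     ≡⟨ cong toℕ p ⟩
  toℕ (b ⊕ s)     ≈⟨ toℕ-⊕ b s ⟩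
  toℕ b + s       ∎))
  where open mod-Reasoning n

⊕-⊖-inverse : ∀ {n} (a : Fin (suc n)) t → a ⊖ t ⊕ t ≡ a
⊕-⊖-inverse {n} a t = begin
  a ⊖ t ⊕ t        ≡⟨ ⊕-assoc a (n * t) t ⟩
  a ⊕ (n * t + t)  ≡⟨ ⊕-congˡ a (mod-trans (≡⇒mod (ℕP.+-comm (n * t) t)) (N*-mod t)) ⟩
  a ⊕ 0            ≡⟨ ⊕-identityʳ a ⟩
  a                ∎
  where open ≡-Reasoning

toℕ+N∸toℕ : ∀ {n} x (a : Fin (suc n)) → x + (suc n ∸ toℕ a) + toℕ a ≡[ n ] x
toℕ+N∸toℕ {n} x a = mod-trans
  (≡⇒mod (trans (ℕP.+-assoc x _ (toℕ a)) (cong (λ w → x + w) (ℕP.m∸n+n≡m (ℕP.<⇒≤ (FinP.toℕ<n a))))))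
  (mod-trans (mod-+ˡ x N-mod) (≡⇒mod (ℕP.+-identityʳ x)))

subF≡⊖ : ∀ {n} (b : Fin (suc n)) d → subF b (d mod suc n) ≡ b ⊖ d
subF≡⊖ {n} b d = mod-cong (mod-+ˡ (toℕ b) (mod-cancelʳ-+ d (begin
  suc n ∸ toℕ c + d       ≈⟨ mod-+ˡ (suc n ∸ toℕ c) (toℕ-mod n d) ⟨
  suc n ∸ toℕ c + toℕ c   ≡⟨ ℕP.m∸n+n≡m (ℕP.<⇒≤ (FinP.toℕ<n c)) ⟩
  suc n                   ≈⟨ N-mod ⟩
  0                       ≈⟨ N*-mod d ⟨
  d + n * d               ≡⟨ ℕP.+-comm d (n * d) ⟩
  n * d + d               ∎)))
  where open mod-Reasoning n
        c = d mod suc n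

-- Finite sums

sumFin-cong : ∀ k {f g : Fin k → ℤ} → (∀ i → f i ≡ g i) → sumFin k f ≡ sumFin k g
sumFin-cong zero    f≡g = refl
sumFin-cong (suc k) f≡g = cong₂ _+ᶻ_ (f≡g Fin.zero) (sumFin-cong k (λ i → f≡g (Fin.suc i)))

sumFin-≋ : ∀ k {M} {f g : Fin k → ℤ} → (∀ i → f i ≋[ M ] g i) → sumFin k f ≋[ M ] sumFin k g
sumFin-≋ zero    f≋g = ≋-refl
sumFin-≋ (suc k) f≋g = ≋-+ (f≋g Fin.zero) (sumFin-≋ k (λ i → f≋g (Fin.suc i)))

sumFin-zero : ∀ k → sumFin k (λ _ → 0ℤ) ≡ 0ℤ
sumFin-zero zero    = refl
sumFin-zero (suc k) = trans (ℤP.+-identityˡ _) (sumFin-zero k)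

sumFin-const : ∀ k c → sumFin k (λ _ → c) ≡ + k *ᶻ c
sumFin-const zero    c = sym (ℤP.*-zeroˡ c)
sumFin-const (suc k) c = trans (cong (c +ᶻ_) (sumFin-const k c)) (identity c (+ k))
  where identity : ∀ c k → c +ᶻ k *ᶻ c ≡ (1ℤ +ᶻ k) *ᶻ c
        identity = solve-∀

sumFin-distrib-+ : ∀ k (f g : Fin k → ℤ) → sumFin k (λ i → f i +ᶻ g i) ≡ sumFin k f +ᶻ sumFin k g
sumFin-distrib-+ zero    f g = refl
sumFin-distrib-+ (suc k) f g =
  trans (cong (f Fin.zero +ᶻ g Fin.zero +ᶻ_) (sumFin-distrib-+ k (λ i → f (Fin.suc i)) (λ i → g (Fin.suc i))))
        (identity (f Fin.zero) (g Fin.zero) _ _)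
  where identity : ∀ a b c d → (a +ᶻ b) +ᶻ (c +ᶻ d) ≡ (a +ᶻ c) +ᶻ (b +ᶻ d)
        identity = solve-∀

sumFin-distrib-- : ∀ k (f g : Fin k → ℤ) → sumFin k (λ i → f i -ᶻ g i) ≡ sumFin k f -ᶻ sumFin k g
sumFin-distrib-- k f g = trans (sumFin-distrib-+ k f (λ i → -ᶻ g i)) (cong (sumFin k f +ᶻ_) (sumFin-neg k g))
  where
  sumFin-neg : ∀ k (f : Fin k → ℤ) → sumFin k (λ i → -ᶻ f i) ≡ -ᶻ sumFin k f
  sumFin-neg zero    f = refl
  sumFin-neg (suc k) f = trans (cong (-ᶻ f Fin.zero +ᶻ_) (sumFin-neg k _)) (sym (ℤP.neg-distrib-+ (f Fin.zero) _))

sumFin-comm : ∀ a b (f : Fin a → Fin b → ℤ) →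
  sumFin a (λ i → sumFin b (f i)) ≡ sumFin b (λ j → sumFin a (λ i → f i j))
sumFin-comm zero    b f = sym (sumFin-zero b)
sumFin-comm (suc a) b f = trans (cong (sumFin b (f Fin.zero) +ᶻ_) (sumFin-comm a b (λ i → f (Fin.suc i))))
  (sym (sumFin-distrib-+ b (f Fin.zero) _))

-- sumℕ (suc k) f reduces to f 0 +ᶻ sumℕ k (f ∘ suc), as toℕ (Fin.suc i) = suc (toℕ i).
sumℕ : ℕ → (ℕ → ℤ) → ℤ
sumℕ k f = sumFin k (λ i → f (toℕ i))

sumℕ-cong : ∀ k {f g : ℕ → ℤ} → (∀ i → f i ≡ g i) → sumℕ k f ≡ sumℕ k g
sumℕ-cong k f≡g = sumFin-cong k (λ i → f≡g (toℕ i))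

sumℕ-≋ : ∀ k {M} {f g : ℕ → ℤ} → (∀ i → f i ≋[ M ] g i) → sumℕ k f ≋[ M ] sumℕ k g
sumℕ-≋ k f≋g = sumFin-≋ k (λ i → f≋g (toℕ i))

sumℕ-++ : ∀ a b (f : ℕ → ℤ) → sumℕ (a + b) f ≡ sumℕ a f +ᶻ sumℕ b (λ j → f (a + j))
sumℕ-++ zero    b f = sym (ℤP.+-identityˡ _)
sumℕ-++ (suc a) b f = trans (cong (f 0 +ᶻ_) (sumℕ-++ a b (λ i → f (suc i)))) (sym (ℤP.+-assoc (f 0) _ _))

sumℕ-last : ∀ k (f : ℕ → ℤ) → sumℕ (suc k) f ≡ sumℕ k f +ᶻ f k
sumℕ-last k f = begin
  sumℕ (suc k) f
    ≡⟨ cong (λ z → sumℕ z f) (ℕP.+-comm 1 k) ⟩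
  sumℕ (k + 1) f
    ≡⟨ sumℕ-++ k 1 f ⟩
  sumℕ k f +ᶻ (f (k + 0) +ᶻ 0ℤ)
    ≡⟨ cong (sumℕ k f +ᶻ_) (trans (ℤP.+-identityʳ _) (cong f (ℕP.+-identityʳ k))) ⟩
  sumℕ k f +ᶻ f k
    ∎
  where open ≡-Reasoning

sumℕ-blocks : ∀ q K (h : ℕ → ℤ) → sumℕ (q * K) h ≡ sumℕ q (λ j → sumℕ K (λ r → h (j * K + r)))
sumℕ-blocks zero    K h = refl
sumℕ-blocks (suc q) K h = trans (sumℕ-++ K (q * K) h)
  (cong (sumℕ K h +ᶻ_) (trans (sumℕ-blocks q K (λ i → h (K + i)))
    (sumℕ-cong q (λ j → sumℕ-cong K (λ r → cong h (sym (ℕP.+-assoc K (j * K) r)))))))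

sumℕ-rotate : ∀ K (f : ℕ → ℤ) → (∀ i → f (i + K) ≡ f i) → sumℕ K (λ i → f (suc i)) ≡ sumℕ K f
sumℕ-rotate zero    f periodic = refl
sumℕ-rotate (suc K) f periodic = trans (sumℕ-last K (λ i → f (suc i)))
  (trans (cong (sumℕ K (λ i → f (suc i)) +ᶻ_) (periodic 0)) (ℤP.+-comm _ (f 0)))

sumℕ-shift : ∀ {K} (f : ℕ → ℤ) → (∀ i → f (i + K) ≡ f i) → ∀ t → sumℕ K (λ i → f (i + t)) ≡ sumℕ K f
sumℕ-shift {K} f periodic zero    = sumℕ-cong K (λ i → cong f (ℕP.+-identityʳ i))
sumℕ-shift {K} f periodic (suc t) = begin
  sumℕ K (λ i → f (i + suc t))   ≡⟨ sumℕ-cong K (λ i → cong f (ℕP.+-suc i t)) ⟩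
  sumℕ K (λ i → f (suc i + t))   ≡⟨ sumℕ-rotate K (λ i → f (i + t)) periodic-t ⟩
  sumℕ K (λ i → f (i + t))       ≡⟨ sumℕ-shift f periodic t ⟩
  sumℕ K f                       ∎
  where
  open ≡-Reasoning
  periodic-t : ∀ i → f (i + K + t) ≡ f (i + t)
  periodic-t i = trans (cong f (identity i K t)) (periodic (i + t))
    where identity : ∀ i K t → i + K + t ≡ i + t + K
          identity = ℕSolver.solve-∀

sumℕ-periodic : ∀ q K (h : ℕ → ℤ) → (∀ i → h (i + K) ≡ h i) → sumℕ (q * K) h ≡ + q *ᶻ sumℕ K h
sumℕ-periodic q K h periodic = begin
  sumℕ (q * K) h
    ≡⟨ sumℕ-blocks q K h ⟩
  sumℕ q (λ j → sumℕ K (λ r → h (j * K + r)))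
    ≡⟨ sumℕ-cong q (λ j → trans (sumℕ-cong K (λ r → cong h (ℕP.+-comm (j * K) r))) (sumℕ-shift h periodic (j * K))) ⟩
  sumℕ q (λ _ → sumℕ K h)
    ≡⟨ sumFin-const q _ ⟩
  + q *ᶻ sumℕ K h
    ∎
  where open ≡-Reasoning

infix 7 [_]·_
[_]·_ : Bool → ℤ → ℤ
[ B ]· x = if B then x else 0ℤ

sumFin-[]· : ∀ k B (g : Fin k → ℤ) → sumFin k (λ a → [ B ]· g a) ≡ [ B ]· sumFin k g
sumFin-[]· k true  g = refl
sumFin-[]· k false g = sumFin-zero k

[]·-∧ : ∀ B C x → (if B ∧ C then x else 0ℤ) ≡ [ B ]· [ C ]· x
[]·-∧ true  C x = refl
[]·-∧ false C x = refl

[]·-comm : ∀ B C x → [ B ]· [ C ]· x ≡ [ C ]· [ B ]· x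
[]·-comm true  C     x = refl
[]·-comm false true  x = refl
[]·-comm false false x = refl

*-indicator : ∀ B x → x *ᶻ (if B then 1ℤ else 0ℤ) ≡ [ B ]· x
*-indicator true  x = ℤP.*-identityʳ x
*-indicator false x = ℤP.*-zeroʳ x

[]·-distrib-- : ∀ B x y → [ B ]· (x -ᶻ y) ≡ [ B ]· x -ᶻ [ B ]· y
[]·-distrib-- true  x y = refl
[]·-distrib-- false x y = refl

[]·-≋ : ∀ B {M x y} → x ≋[ M ] y → [ B ]· x ≋[ M ] [ B ]· y
[]·-≋ true  p = p
[]·-≋ false p = ≋-refl

⌊⌋-≡ : ∀ {P Q : Set} (p : Dec P) (q : Dec Q) → (P → Q) → (Q → P) → ⌊ p ⌋ ≡ ⌊ q ⌋
⌊⌋-≡ (yes p) (yes q) f g = refl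
⌊⌋-≡ (yes p) (no ¬q) f g = ⊥-elim (¬q (f p))
⌊⌋-≡ (no ¬p) (yes q) f g = ⊥-elim (¬p (g q))
⌊⌋-≡ (no ¬p) (no ¬q) f g = refl

sumFin-δ : ∀ k (c : Fin k) (f : Fin k → ℤ) → sumFin k (λ a → [ ⌊ a Fin.≟ c ⌋ ]· f a) ≡ f c
sumFin-δ (suc k) Fin.zero f =
  trans (cong (f Fin.zero +ᶻ_) (sumFin-zero k)) (ℤP.+-identityʳ _)
sumFin-δ (suc k) (Fin.suc c) f = trans (ℤP.+-identityˡ _) (trans
  (sumFin-cong k (λ i → cong (λ B → [ B ]· f (Fin.suc i))
    (⌊⌋-≡ (Fin.suc i Fin.≟ Fin.suc c) (i Fin.≟ c) FinP.suc-injective (cong Fin.suc))))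
  (sumFin-δ k c (λ i → f (Fin.suc i))))

sumFin-δ′ : ∀ k (c : Fin k) (f : Fin k → ℤ) → sumFin k (λ a → [ ⌊ c Fin.≟ a ⌋ ]· f a) ≡ f c
sumFin-δ′ k c f =
  trans (sumFin-cong k (λ a → cong (λ B → [ B ]· f a) (⌊⌋-≡ (c Fin.≟ a) (a Fin.≟ c) sym sym))) (sumFin-δ k c f)

sumFin-δ-toℕ : ∀ n (b : Fin (suc n)) (G : ℕ → ℤ) →
  sumℕ (suc n) (λ r → [ ⌊ r mod suc n Fin.≟ b ⌋ ]· G r) ≡ G (toℕ b)
sumFin-δ-toℕ n b G =
  trans (sumFin-cong (suc n) (λ c → cong (λ z → [ ⌊ z Fin.≟ b ⌋ ]· G (toℕ c)) (toℕ-mod-id c)))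
        (sumFin-δ (suc n) b (λ c → G (toℕ c)))

sumFin-as-sumℕ : ∀ n (F : Fin (suc n) → ℤ) → sumFin (suc n) F ≡ sumℕ (suc n) (λ i → F (i mod suc n))
sumFin-as-sumℕ n F = sumFin-cong (suc n) (λ a → cong F (sym (toℕ-mod-id a)))

sumFin-⊕ : ∀ n (F : Fin (suc n) → ℤ) r → sumFin (suc n) (λ a → F (a ⊕ r)) ≡ sumFin (suc n) F
sumFin-⊕ n F r = begin
  sumFin (suc n) (λ a → F (a ⊕ r))              ≡⟨ sumFin-as-sumℕ n (λ a → F (a ⊕ r)) ⟩
  sumℕ (suc n) (λ i → F ((i mod suc n) ⊕ r))   ≡⟨ sumℕ-cong (suc n) (λ i → cong F (mod-⊕ n i r)) ⟩
  sumℕ (suc n) (λ i → F ((i + r) mod suc n))   ≡⟨ sumℕ-shift (λ i → F (i mod suc n)) N-periodic r ⟩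
  sumℕ (suc n) (λ i → F (i mod suc n))         ≡⟨ sumFin-as-sumℕ n F ⟨
  sumFin (suc n) F                              ∎
  where
  open ≡-Reasoning
  N-periodic : ∀ i → F ((i + suc n) mod suc n) ≡ F (i mod suc n)
  N-periodic i = cong F (mod-cong (mod-trans (mod-+ˡ i N-mod) (≡⇒mod (ℕP.+-identityʳ i))))

-- Pushforward along maps of finite sets

push₁ : ∀ {A B} → (Fin A → Fin B) → (Fin A → ℤ) → Fin B → ℤ
push₁ {A} φ g b = sumFin A (λ a → [ ⌊ φ a Fin.≟ b ⌋ ]· g a)

module _ {A B : ℕ} (φ : Fin A → Fin B) where

  push₁-cong : ∀ {g h : Fin A → ℤ} → (∀ a → g a ≡ h a) → ∀ b → push₁ φ g b ≡ push₁ φ h b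
  push₁-cong g≡h b = sumFin-cong A (λ a → cong [ ⌊ φ a Fin.≟ b ⌋ ]·_ (g≡h a))

  push₁-≋ : ∀ {M} {g h : Fin A → ℤ} → (∀ a → g a ≋[ M ] h a) → ∀ b → push₁ φ g b ≋[ M ] push₁ φ h b
  push₁-≋ g≋h b = sumFin-≋ A (λ a → []·-≋ ⌊ φ a Fin.≟ b ⌋ (g≋h a))

  push₁-distrib-- : ∀ g h b → push₁ φ (λ a → g a -ᶻ h a) b ≡ push₁ φ g b -ᶻ push₁ φ h b
  push₁-distrib-- g h b =
    trans (sumFin-cong A (λ a → []·-distrib-- ⌊ φ a Fin.≟ b ⌋ (g a) (h a))) (sumFin-distrib-- A _ _)

  push₁-sumℕ : ∀ K (F : ℕ → Fin A → ℤ) b →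
    push₁ φ (λ a → sumℕ K (λ j → F j a)) b ≡ sumℕ K (λ j → push₁ φ (F j) b)
  push₁-sumℕ K F b = trans (sumFin-cong A (λ a → sym (sumFin-[]· K ⌊ φ a Fin.≟ b ⌋ (λ j → F (toℕ j) a))))
    (sumFin-comm A K _)

push₁-congˡ : ∀ {A B} {φ ψ : Fin A → Fin B} → (∀ a → φ a ≡ ψ a) → ∀ g b → push₁ φ g b ≡ push₁ ψ g b
push₁-congˡ {A} φ≡ψ g b = sumFin-cong A (λ a → cong (λ c → [ ⌊ c Fin.≟ b ⌋ ]· g a) (φ≡ψ a))

push₁-id : ∀ {A} {φ : Fin A → Fin A} → (∀ a → φ a ≡ a) → ∀ g b → push₁ φ g b ≡ g b
push₁-id {A} φ≡id g b = trans (push₁-congˡ φ≡id g b) (sumFin-δ A b g)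

push₁-∘ : ∀ {A B C} (φ : Fin B → Fin C) (ψ : Fin A → Fin B) g c →
  push₁ φ (push₁ ψ g) c ≡ push₁ (λ a → φ (ψ a)) g c
push₁-∘ {A} {B} φ ψ g c = begin
  sumFin B (λ b → [ ⌊ φ b Fin.≟ c ⌋ ]· sumFin A (λ a → [ ⌊ ψ a Fin.≟ b ⌋ ]· g a))
    ≡⟨ sumFin-cong B (λ b → sumFin-[]· A ⌊ φ b Fin.≟ c ⌋ _) ⟨
  sumFin B (λ b → sumFin A (λ a → [ ⌊ φ b Fin.≟ c ⌋ ]· [ ⌊ ψ a Fin.≟ b ⌋ ]· g a))
    ≡⟨ sumFin-comm B A _ ⟩
  sumFin A (λ a → sumFin B (λ b → [ ⌊ φ b Fin.≟ c ⌋ ]· [ ⌊ ψ a Fin.≟ b ⌋ ]· g a))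
    ≡⟨ sumFin-cong A (λ a → sumFin-cong B (λ b → []·-comm ⌊ φ b Fin.≟ c ⌋ ⌊ ψ a Fin.≟ b ⌋ (g a))) ⟩
  sumFin A (λ a → sumFin B (λ b → [ ⌊ ψ a Fin.≟ b ⌋ ]· [ ⌊ φ b Fin.≟ c ⌋ ]· g a))
    ≡⟨ sumFin-cong A (λ a → sumFin-δ′ B (ψ a) (λ b → [ ⌊ φ b Fin.≟ c ⌋ ]· g a)) ⟩
  sumFin A (λ a → [ ⌊ φ (ψ a) Fin.≟ c ⌋ ]· g a)
    ∎
  where open ≡-Reasoning

push₁-comm : ∀ {A A' B B'} (φ : Fin A' → Fin B') (ψ : Fin A → Fin B) (h : Fin A → Fin A' → ℤ) x y →
  push₁ φ (λ c → push₁ ψ (λ a → h a c) x) y ≡ push₁ ψ (λ a → push₁ φ (h a) y) x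
push₁-comm {A} {A'} φ ψ h x y = begin
  sumFin A' (λ c → [ ⌊ φ c Fin.≟ y ⌋ ]· sumFin A (λ a → [ ⌊ ψ a Fin.≟ x ⌋ ]· h a c))
    ≡⟨ sumFin-cong A' (λ c → sumFin-[]· A ⌊ φ c Fin.≟ y ⌋ _) ⟨
  sumFin A' (λ c → sumFin A (λ a → [ ⌊ φ c Fin.≟ y ⌋ ]· [ ⌊ ψ a Fin.≟ x ⌋ ]· h a c))
    ≡⟨ sumFin-comm A' A _ ⟩
  sumFin A (λ a → sumFin A' (λ c → [ ⌊ φ c Fin.≟ y ⌋ ]· [ ⌊ ψ a Fin.≟ x ⌋ ]· h a c))
    ≡⟨ sumFin-cong A (λ a → sumFin-cong A' (λ c → []·-comm ⌊ φ c Fin.≟ y ⌋ ⌊ ψ a Fin.≟ x ⌋ (h a c))) ⟩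
  sumFin A (λ a → sumFin A' (λ c → [ ⌊ ψ a Fin.≟ x ⌋ ]· [ ⌊ φ c Fin.≟ y ⌋ ]· h a c))
    ≡⟨ sumFin-cong A (λ a → sumFin-[]· A' ⌊ ψ a Fin.≟ x ⌋ _) ⟩
  sumFin A (λ a → [ ⌊ ψ a Fin.≟ x ⌋ ]· sumFin A' (λ c → [ ⌊ φ c Fin.≟ y ⌋ ]· h a c))
    ∎
  where open ≡-Reasoning

push₁-⊕ : ∀ {a' b'} (φ : Fin (suc a') → Fin (suc b')) t s →
  (∀ a → φ (a ⊕ t) ≡ φ a ⊕ s) → ∀ g b → push₁ φ (λ a → g (a ⊕ t)) b ≡ push₁ φ g (b ⊕ s)
push₁-⊕ {a'} φ t s φ-⊕ g b = trans
  (sym (sumFin-⊕ a' (λ a → [ ⌊ φ a Fin.≟ b ⌋ ]· g (a ⊕ t)) (a' * t)))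
  (sumFin-cong (suc a') (λ a → cong₂ [_]·_ (indicator a) (cong g (⊕-⊖-inverse a t))))
  where
  indicator : ∀ a → ⌊ φ (a ⊖ t) Fin.≟ b ⌋ ≡ ⌊ φ a Fin.≟ b ⊕ s ⌋
  indicator a = ⌊⌋-≡ _ _
    (λ e → trans (cong φ (sym (⊕-⊖-inverse a t))) (trans (φ-⊕ (a ⊖ t)) (cong (_⊕ s) e)))
    (λ e → ⊕-cancelʳ s (trans (sym (φ-⊕ (a ⊖ t))) (trans (cong φ (⊕-⊖-inverse a t)) e)))

push₂ : ∀ {A B} → (Fin A → Fin B) → (Fin A → Fin A → ℤ) → Fin B → Fin B → ℤ
push₂ φ f b₁ b₂ = push₁ φ (λ a₁ → push₁ φ (f a₁) b₂) b₁

push≡push₂ : ∀ {A B} (φ : Fin A → Fin B) f b₁ b₂ → push φ f b₁ b₂ ≡ push₂ φ f b₁ b₂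
push≡push₂ {A} φ f b₁ b₂ = sumFin-cong A (λ a₁ → trans
  (sumFin-cong A (λ a₂ → []·-∧ ⌊ φ a₁ Fin.≟ b₁ ⌋ ⌊ φ a₂ Fin.≟ b₂ ⌋ (f a₁ a₂)))
  (sumFin-[]· A ⌊ φ a₁ Fin.≟ b₁ ⌋ _))

module _ {A B : ℕ} (φ : Fin A → Fin B) where

  push₂-cong : ∀ {f g : Fin A → Fin A → ℤ} → (∀ a₁ a₂ → f a₁ a₂ ≡ g a₁ a₂) →
    ∀ b₁ b₂ → push₂ φ f b₁ b₂ ≡ push₂ φ g b₁ b₂
  push₂-cong f≡g b₁ b₂ = push₁-cong φ (λ a₁ → push₁-cong φ (f≡g a₁) b₂) b₁

  push₂-≋ : ∀ {M} {f g : Fin A → Fin A → ℤ} → (∀ a₁ a₂ → f a₁ a₂ ≋[ M ] g a₁ a₂) →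
    ∀ b₁ b₂ → push₂ φ f b₁ b₂ ≋[ M ] push₂ φ g b₁ b₂
  push₂-≋ f≋g b₁ b₂ = push₁-≋ φ (λ a₁ → push₁-≋ φ (f≋g a₁) b₂) b₁

  push₂-distrib-- : ∀ f g b₁ b₂ →
    push₂ φ (λ a₁ a₂ → f a₁ a₂ -ᶻ g a₁ a₂) b₁ b₂ ≡ push₂ φ f b₁ b₂ -ᶻ push₂ φ g b₁ b₂
  push₂-distrib-- f g b₁ b₂ =
    trans (push₁-cong φ (λ a₁ → push₁-distrib-- φ (f a₁) (g a₁) b₂) b₁) (push₁-distrib-- φ _ _ b₁)

  push₂-sumℕ : ∀ K (F : ℕ → Fin A → Fin A → ℤ) b₁ b₂ →
    push₂ φ (λ a₁ a₂ → sumℕ K (λ j → F j a₁ a₂)) b₁ b₂ ≡ sumℕ K (λ j → push₂ φ (F j) b₁ b₂)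
  push₂-sumℕ K F b₁ b₂ = trans (push₁-cong φ (λ a₁ → push₁-sumℕ φ K (λ j → F j a₁) b₂) b₁)
    (push₁-sumℕ φ K (λ j a₁ → push₁ φ (F j a₁) b₂) b₁)

push₂-congˡ : ∀ {A B} {φ ψ : Fin A → Fin B} → (∀ a → φ a ≡ ψ a) → ∀ f b₁ b₂ →
  push₂ φ f b₁ b₂ ≡ push₂ ψ f b₁ b₂
push₂-congˡ {φ = φ} φ≡ψ f b₁ b₂ =
  trans (push₁-cong φ (λ a₁ → push₁-congˡ φ≡ψ (f a₁) b₂) b₁) (push₁-congˡ φ≡ψ _ b₁)

push₂-id : ∀ {A} {φ : Fin A → Fin A} → (∀ a → φ a ≡ a) → ∀ f b₁ b₂ → push₂ φ f b₁ b₂ ≡ f b₁ b₂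
push₂-id {φ = φ} φ≡id f b₁ b₂ = trans (push₁-cong φ (λ a₁ → push₁-id φ≡id (f a₁) b₂) b₁) (push₁-id φ≡id _ b₁)

push₂-∘ : ∀ {A B C} (φ : Fin B → Fin C) (ψ : Fin A → Fin B) f c₁ c₂ →
  push₂ φ (push₂ ψ f) c₁ c₂ ≡ push₂ (λ a → φ (ψ a)) f c₁ c₂
push₂-∘ φ ψ f c₁ c₂ = trans
  (push₁-cong φ (λ b₁ → trans (push₁-comm φ ψ (λ a₁ b₂ → push₁ ψ (f a₁) b₂) b₁ c₂)
                              (push₁-cong ψ (λ a₁ → push₁-∘ φ ψ (f a₁) c₂) b₁)) c₁)
  (push₁-∘ φ ψ _ c₁)

push₂-⊕ : ∀ {a' b'} (φ : Fin (suc a') → Fin (suc b')) t₁ t₂ s₁ s₂ →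
  (∀ a → φ (a ⊕ t₁) ≡ φ a ⊕ s₁) → (∀ a → φ (a ⊕ t₂) ≡ φ a ⊕ s₂) → ∀ f b₁ b₂ →
  push₂ φ (λ a₁ a₂ → f (a₁ ⊕ t₁) (a₂ ⊕ t₂)) b₁ b₂ ≡ push₂ φ f (b₁ ⊕ s₁) (b₂ ⊕ s₂)
push₂-⊕ φ t₁ t₂ s₁ s₂ φ-⊕₁ φ-⊕₂ f b₁ b₂ =
  trans (push₁-cong φ (λ a₁ → push₁-⊕ φ t₂ s₂ φ-⊕₂ (f (a₁ ⊕ t₁)) b₂) b₁)
        (push₁-⊕ φ t₁ s₁ φ-⊕₁ (λ a₁ → push₁ φ (f a₁) (b₂ ⊕ s₂)) b₁)

-- Multiplication by 1 - x

subF-swap : ∀ {n} (b a t : Fin (suc n)) → subF b a ≡ t → a ≡ subF b t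
subF-swap {n} b a t b-a≡t = toℕ-injective-mod (mod-sym (begin
  toℕ (subF b t)                                   ≈⟨ toℕ-mod n _ ⟩
  toℕ b + (suc n ∸ toℕ t)                          ≈⟨ mod-+ʳ (suc n ∸ toℕ t) b≡t+a ⟩
  toℕ t + toℕ a + (suc n ∸ toℕ t)                  ≡⟨ identity (toℕ t) (toℕ a) (suc n ∸ toℕ t) ⟩
  toℕ a + (suc n ∸ toℕ t) + toℕ t                  ≈⟨ toℕ+N∸toℕ (toℕ a) t ⟩
  toℕ a                                            ∎))
  where
  open mod-Reasoning n
  identity : ∀ x y w → x + y + w ≡ y + w + x
  identity = ℕSolver.solve-∀
  b≡t+a : toℕ b ≡[ n ] toℕ t + toℕ a
  b≡t+a = begin
    toℕ b                                ≈⟨ toℕ+N∸toℕ (toℕ b) a ⟨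
    toℕ b + (suc n ∸ toℕ a) + toℕ a      ≈⟨ mod-+ʳ (toℕ a) (toℕ-mod n _) ⟨
    toℕ (subF b a) + toℕ a               ≡⟨ cong (λ c → toℕ c + toℕ a) b-a≡t ⟩
    toℕ t + toℕ a                        ∎

*Λ-distribʳ--Λ : ∀ (l c d : Raw) n b₁ b₂ m →
  (l *Λ (c -Λ d)) n b₁ b₂ m ≡ (l *Λ c) n b₁ b₂ m -ᶻ (l *Λ d) n b₁ b₂ m
*Λ-distribʳ--Λ l c d n b₁ b₂ m = trans
  (sumFin-cong (suc n) (λ a₁ → trans
    (sumFin-cong (suc n) (λ a₂ → identity (l n a₁ a₂ m) (c n (subF b₁ a₁) (subF b₂ a₂) m) (d n (subF b₁ a₁) (subF b₂ a₂) m)))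
    (sumFin-distrib-- (suc n) (term c a₁) (term d a₁))))
  (sumFin-distrib-- (suc n) (λ a₁ → sumFin (suc n) (term c a₁)) (λ a₁ → sumFin (suc n) (term d a₁)))
  where
  identity : ∀ x p q → x *ᶻ (p -ᶻ q) ≡ x *ᶻ p -ᶻ x *ᶻ q
  identity = solve-∀
  term : Raw → Fin (suc n) → Fin (suc n) → ℤ
  term e a₁ a₂ = l n a₁ a₂ m *ᶻ e n (subF b₁ a₁) (subF b₂ a₂) m

*Λ-pt : ∀ (l : Raw) e₁ e₂ n b₁ b₂ m → (l *Λ pt e₁ e₂) n b₁ b₂ m ≡ l n (b₁ ⊖ e₁) (b₂ ⊖ e₂) m
*Λ-pt l e₁ e₂ n b₁ b₂ m = begin
  sumFin (suc n) (λ a₁ → sumFin (suc n) (λ a₂ → l n a₁ a₂ m *ᶻ pt e₁ e₂ n (subF b₁ a₁) (subF b₂ a₂) m))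
    ≡⟨ sumFin-cong (suc n) (λ a₁ → trans (sumFin-cong (suc n) (λ a₂ →
         trans (*-indicator _ (l n a₁ a₂ m)) ([]·-∧ (δ b₁ a₁ c₁) (δ b₂ a₂ c₂) _)))
         (sumFin-[]· (suc n) (δ b₁ a₁ c₁) (λ a₂ → [ δ b₂ a₂ c₂ ]· l n a₁ a₂ m))) ⟩
  sumFin (suc n) (λ a₁ → [ δ b₁ a₁ c₁ ]· sumFin (suc n) (λ a₂ → [ δ b₂ a₂ c₂ ]· l n a₁ a₂ m))
    ≡⟨ sumFin-cong (suc n) (λ a₁ → cong₂ [_]·_ (δ-swap b₁ a₁ c₁)
         (trans (sumFin-cong (suc n) (λ a₂ → cong (λ B → [ B ]· l n a₁ a₂ m) (δ-swap b₂ a₂ c₂)))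
           (sumFin-δ (suc n) (subF b₂ c₂) (λ a₂ → l n a₁ a₂ m)))) ⟩
  sumFin (suc n) (λ a₁ → [ ⌊ a₁ Fin.≟ subF b₁ c₁ ⌋ ]· l n a₁ (subF b₂ c₂) m)
    ≡⟨ sumFin-δ (suc n) (subF b₁ c₁) (λ a₁ → l n a₁ (subF b₂ c₂) m) ⟩
  l n (subF b₁ c₁) (subF b₂ c₂) m
    ≡⟨ cong₂ (λ x y → l n x y m) (subF≡⊖ b₁ e₁) (subF≡⊖ b₂ e₂) ⟩
  l n (b₁ ⊖ e₁) (b₂ ⊖ e₂) m
    ∎
  where
  open ≡-Reasoning
  c₁ = e₁ mod suc n
  c₂ = e₂ mod suc n
  δ : Fin (suc n) → Fin (suc n) → Fin (suc n) → Bool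
  δ b a c = ⌊ subF b a Fin.≟ c ⌋
  δ-swap : ∀ b a c → δ b a c ≡ ⌊ a Fin.≟ subF b c ⌋
  δ-swap b a c = ⌊⌋-≡ _ _ (subF-swap b a c) (λ e → sym (subF-swap b c a (sym e)))

⊖-identityʳ : ∀ {n} (b : Fin (suc n)) → b ⊖ 0 ≡ b
⊖-identityʳ {n} b = trans (⊕-congˡ b (≡⇒mod (ℕP.*-zeroʳ n))) (⊕-identityʳ b)

*Λ-1-pt : ∀ (l : Raw) d₁ d₂ n b₁ b₂ m →
  (l *Λ (1Λ -Λ pt d₁ d₂)) n b₁ b₂ m ≡ l n b₁ b₂ m -ᶻ l n (b₁ ⊖ d₁) (b₂ ⊖ d₂) m
*Λ-1-pt l d₁ d₂ n b₁ b₂ m = begin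
  (l *Λ (1Λ -Λ pt d₁ d₂)) n b₁ b₂ m
    ≡⟨ *Λ-distribʳ--Λ l 1Λ (pt d₁ d₂) n b₁ b₂ m ⟩
  (l *Λ 1Λ) n b₁ b₂ m -ᶻ (l *Λ pt d₁ d₂) n b₁ b₂ m
    ≡⟨ cong₂ _-ᶻ_ (*Λ-pt l 0 0 n b₁ b₂ m) (*Λ-pt l d₁ d₂ n b₁ b₂ m) ⟩
  l n (b₁ ⊖ 0) (b₂ ⊖ 0) m -ᶻ l n (b₁ ⊖ d₁) (b₂ ⊖ d₂) m
    ≡⟨ cong (_-ᶻ l n (b₁ ⊖ d₁) (b₂ ⊖ d₂) m) (cong₂ (λ x y → l n x y m) (⊖-identityʳ b₁) (⊖-identityʳ b₂)) ⟩
  l n b₁ b₂ m -ᶻ l n (b₁ ⊖ d₁) (b₂ ⊖ d₂) m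
    ∎
  where open ≡-Reasoning

-- 1 - x is not a zero divisor

-- suc (mulLevel n m) reduces to suc n * suc m: the level of Δ_{N(m+1)} above Δ_N.
mulLevel : ℕ → ℕ → ℕ
mulLevel n m = m + n * suc m

N∣mulLevel : ∀ n m → suc n ℕD.∣ suc (mulLevel n m)
N∣mulLevel n m = ℕD.m∣m*n (suc m)

proj-mod : ∀ n n' → suc n ℕD.∣ suc n' → ∀ x → proj n (x mod suc n') ≡ x mod suc n
proj-mod n n' n∣n' x = mod-cong (mod-weaken n∣n' (toℕ-mod n' x))

push₁-proj : ∀ n m (g : Fin (suc (mulLevel n m)) → ℤ) (b : Fin (suc n)) →
  push₁ (proj n) g b ≡ sumℕ (suc m) (λ j → g ((j * suc n + toℕ b) mod suc (mulLevel n m)))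
push₁-proj n m g b = begin
  push₁ (proj n) g b
    ≡⟨ sumFin-as-sumℕ (mulLevel n m) (λ a → [ ⌊ proj n a Fin.≟ b ⌋ ]· g a) ⟩
  sumℕ (suc n * suc m) h
    ≡⟨ cong (λ z → sumℕ z h) (ℕP.*-comm (suc n) (suc m)) ⟩
  sumℕ (suc m * suc n) h
    ≡⟨ sumℕ-blocks (suc m) (suc n) h ⟩
  sumℕ (suc m) (λ j → sumℕ (suc n) (λ r → h (j * suc n + r)))
    ≡⟨ sumℕ-cong (suc m) (λ j → trans (sumℕ-cong (suc n) (λ r → cong (λ c → [ ⌊ c Fin.≟ b ⌋ ]· G j r) (fibre j r)))
                                       (sumFin-δ-toℕ n b (G j))) ⟩
  sumℕ (suc m) (λ j → G j (toℕ b))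
    ∎
  where
  open ≡-Reasoning
  N' = suc (mulLevel n m)
  h : ℕ → ℤ
  h i = [ ⌊ proj n (i mod N') Fin.≟ b ⌋ ]· g (i mod N')
  G : ℕ → ℕ → ℤ
  G j r = g ((j * suc n + r) mod N')
  fibre : ∀ j r → proj n ((j * suc n + r) mod N') ≡ r mod suc n
  fibre j r = trans (proj-mod n (mulLevel n m) (N∣mulLevel n m) (j * suc n + r))
                    (mod-cong (mod-trans (≡⇒mod (ℕP.+-comm (j * suc n) r)) (+-*N-mod r j)))

-- the coefficients of l at level N (m + 1), as a function of integer exponents
fine : Raw → ℕ → ℕ → ℕ → ℕ → ℤ
fine l n m i₁ i₂ = l (mulLevel n m) (i₁ mod suc (mulLevel n m)) (i₂ mod suc (mulLevel n m)) m

≋-sum-fibres : ∀ l → IsΛ l → ∀ n m b₁ b₂ →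
  l n b₁ b₂ m ≋[ suc m ] sumℕ (suc m) (λ j → sumℕ (suc m) (λ k → fine l n m (j * suc n + toℕ b₁) (k * suc n + toℕ b₂)))
≋-sum-fibres l (_ , compatible) n m b₁ b₂ = ≋-trans
  (≋-sym (Cong⇒≋ (compatible n (mulLevel n m) (N∣mulLevel n m) b₁ b₂ m)))
  (≡⇒≋ (trans (push≡push₂ (proj n) l' b₁ b₂) (trans (push₁-proj n m (λ a₁ → push₁ (proj n) (l' a₁) b₂) b₁)
    (sumℕ-cong (suc m) (λ j → push₁-proj n m (l' ((j * suc n + toℕ b₁) mod suc (mulLevel n m))) b₂)))))
  where l' : Fin (suc (mulLevel n m)) → Fin (suc (mulLevel n m)) → ℤ
        l' a₁ a₂ = l (mulLevel n m) a₁ a₂ m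

mod-+-period : ∀ n m x → (x + suc m * suc n) mod suc (mulLevel n m) ≡ x mod suc (mulLevel n m)
mod-+-period n m x = mod-cong (mod-trans (mod-+ˡ x (≡⇒mod (ℕP.*-comm (suc m) (suc n))))
                                         (mod-trans (mod-+ˡ x N-mod) (≡⇒mod (ℕP.+-identityʳ x))))

fine-periodicˡ : ∀ l n m x y → fine l n m (x + suc m * suc n) y ≡ fine l n m x y
fine-periodicˡ l n m x y = cong (λ c → l (mulLevel n m) c (y mod suc (mulLevel n m)) m) (mod-+-period n m x)

fine-periodicʳ : ∀ l n m x y → fine l n m x (y + suc m * suc n) ≡ fine l n m x y
fine-periodicʳ l n m x y = cong (λ c → l (mulLevel n m) (x mod suc (mulLevel n m)) c m) (mod-+-period n m y)

module _ (d₁ d₂ : ℕ) (l : Raw)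
  (invariant : ∀ n b₁ b₂ m → l n b₁ b₂ m ≋[ suc m ] l n (b₁ ⊖ d₁) (b₂ ⊖ d₂) m) where

  fine-invariant : ∀ n m t i₁ i₂ → fine l n m (i₁ + t * d₁) (i₂ + t * d₂) ≋[ suc m ] fine l n m i₁ i₂
  fine-invariant n m zero    i₁ i₂ = ≡⇒≋ (cong₂ (fine l n m) (ℕP.+-identityʳ i₁) (ℕP.+-identityʳ i₂))
  fine-invariant n m (suc t) i₁ i₂ = begin
    fine l n m (i₁ + (d₁ + t * d₁)) (i₂ + (d₂ + t * d₂))
      ≡⟨ cong₂ (fine l n m) (identity i₁ d₁ t) (identity i₂ d₂ t) ⟩
    fine l n m (i₁ + t * d₁ + d₁) (i₂ + t * d₂ + d₂)
      ≈⟨ invariant′ (i₁ + t * d₁) (i₂ + t * d₂) ⟩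
    fine l n m (i₁ + t * d₁) (i₂ + t * d₂)
      ≈⟨ fine-invariant n m t i₁ i₂ ⟩
    fine l n m i₁ i₂
      ∎
    where
    open ≋-Reasoning (suc m)
    N' = mulLevel n m
    identity : ∀ i d t → i + (d + t * d) ≡ i + t * d + d
    identity = ℕSolver.solve-∀
    ⊖-cancel : ∀ i d → (i + d) mod suc N' ⊖ d ≡ i mod suc N'
    ⊖-cancel i d = trans (mod-⊕ N' (i + d) (N' * d))
      (mod-cong (mod-trans (≡⇒mod (ℕP.+-assoc i d _)) (+-N*-mod i d)))
    invariant′ : ∀ i j → fine l n m (i + d₁) (j + d₂) ≋[ suc m ] fine l n m i j
    invariant′ i j = ≋-trans (invariant N' _ _ m) (≡⇒≋ (cong₂ (λ x y → l N' x y m) (⊖-cancel i d₁) (⊖-cancel j d₂)))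

-- Each row j has the same sum as row 0: translate by (j N, j N d) and re-index k ↦ k + j d.
grid-sum-≋0 : ∀ N M (L : ℕ → ℕ → ℤ) d B₁ B₂ →
  (∀ x y → L x (y + M * N) ≡ L x y) → (∀ t x y → L (x + t) (y + t * d) ≋[ M ] L x y) →
  sumℕ M (λ j → sumℕ M (λ k → L (j * N + B₁) (k * N + B₂))) ≋[ M ] 0ℤ
grid-sum-≋0 N M L d B₁ B₂ periodic invariant = begin
  sumℕ M (λ j → sumℕ M (row j))  ≈⟨ sumℕ-≋ M row≋row₀ ⟩
  sumℕ M (λ _ → X)               ≡⟨ sumFin-const M X ⟩
  + M *ᶻ X                       ≈⟨ M*x≋0 X ⟩
  0ℤ                             ∎
  where
  open ≋-Reasoning M
  row : ℕ → ℕ → ℤ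
  row j k = L (j * N + B₁) (k * N + B₂)
  X = sumℕ M (λ k → L B₁ (k * N + B₂))
  row-periodic : ∀ j k → row j (k + M) ≡ row j k
  row-periodic j k = trans (cong (L (j * N + B₁)) (identity k M N B₂)) (periodic _ _)
    where identity : ∀ k M N B → (k + M) * N + B ≡ k * N + B + M * N
          identity = ℕSolver.solve-∀
  row≋row₀ : ∀ j → sumℕ M (row j) ≋[ M ] X
  row≋row₀ j = ≋-trans (≡⇒≋ (sym (sumℕ-shift (row j) (row-periodic j) (j * d))))
    (sumℕ-≋ M (λ k → ≋-trans (≡⇒≋ (cong₂ L (ℕP.+-comm (j * N) B₁) (identity k j d N B₂)))
                              (invariant (j * N) B₁ (k * N + B₂))))
    where identity : ∀ k j d N B → (k + j * d) * N + B ≡ k * N + B + j * N * d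
          identity = ℕSolver.solve-∀

1-pt-annihilator-invariant : ∀ d₁ d₂ (l : Raw) → (l *Λ (1Λ -Λ pt d₁ d₂)) ≈Λ 0Λ →
  ∀ n b₁ b₂ m → l n b₁ b₂ m ≋[ suc m ] l n (b₁ ⊖ d₁) (b₂ ⊖ d₂) m
1-pt-annihilator-invariant d₁ d₂ l l·[1-x]≈0 n b₁ b₂ m =
  a-b≋0⇒a≋b (≋-trans (≡⇒≋ (sym (*Λ-1-pt l d₁ d₂ n b₁ b₂ m))) (Cong⇒≋ (l·[1-x]≈0 n b₁ b₂ m)))

1-ξηᵈ-non-zero-divisor : ∀ d (l : Raw) → IsΛ l → (l *Λ (1Λ -Λ pt 1 d)) ≈Λ 0Λ → l ≈Λ 0Λ
1-ξηᵈ-non-zero-divisor d l isΛ l·[1-x]≈0 n b₁ b₂ m = ≋⇒Cong (≋-trans (≋-sum-fibres l isΛ n m b₁ b₂)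
  (grid-sum-≋0 (suc n) (suc m) (fine l n m) d (toℕ b₁) (toℕ b₂)
    (fine-periodicʳ l n m)
    (λ t x y → ≋-trans (≡⇒≋ (cong (λ z → fine l n m (x + z) (y + t * d)) (sym (ℕP.*-identityʳ t))))
                       (fine-invariant 1 d l (1-pt-annihilator-invariant 1 d l l·[1-x]≈0) n m t x y))))

1-η-non-zero-divisor : (l : Raw) → IsΛ l → (l *Λ (1Λ -Λ η)) ≈Λ 0Λ → l ≈Λ 0Λ
1-η-non-zero-divisor l isΛ l·[1-η]≈0 n b₁ b₂ m = ≋⇒Cong (begin
  l n b₁ b₂ m
    ≈⟨ ≋-sum-fibres l isΛ n m b₁ b₂ ⟩
  sumℕ (suc m) (λ j → sumℕ (suc m) (λ k → fine l n m (j * suc n + toℕ b₁) (k * suc n + toℕ b₂)))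
    ≡⟨ sumFin-comm (suc m) (suc m) (λ j k → fine l n m (toℕ j * suc n + toℕ b₁) (toℕ k * suc n + toℕ b₂)) ⟩
  sumℕ (suc m) (λ k → sumℕ (suc m) (λ j → fine l n m (j * suc n + toℕ b₁) (k * suc n + toℕ b₂)))
    ≈⟨ grid-sum-≋0 (suc n) (suc m) (λ x y → fine l n m y x) 0 (toℕ b₂) (toℕ b₁)
         (λ x y → fine-periodicˡ l n m y x)
         (λ t x y → ≋-trans (≡⇒≋ (cong (λ z → fine l n m (y + t * 0) (x + z)) (sym (ℕP.*-identityʳ t))))
                            (fine-invariant 0 1 l (1-pt-annihilator-invariant 0 1 l l·[1-η]≈0) n m t y x)) ⟩
  0ℤ
    ∎)
  where open ≋-Reasoning (suc m)

-- Stability of Λ (1 - x) under the Galois action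

exponent : RawẐ → ℕ → ℕ
exponent u n = u n %ℕ suc n

exponent-compatible : ∀ (u : RawẐ) → IsẐ u → ∀ n n' → suc n ℕD.∣ suc n' →
  u n' %ℕ suc n' ≡[ n ] exponent u n
exponent-compatible u isẐ n n' n∣n' = +≋+⇒mod _ _ (begin
  + (u n' %ℕ suc n')   ≈⟨ ≋-weaken n∣n' (%ℕ-≋ (u n') n') ⟩
  u n'                 ≈⟨ Cong⇒≋ (isẐ n n' n∣n') ⟩
  u n                  ≈⟨ %ℕ-≋ (u n) n ⟨
  + exponent u n       ∎)
  where open ≋-Reasoning (suc n)

scale-⊕ : ∀ u n (a : Fin (suc n)) t → scale u n (a ⊕ t) ≡ scale u n a ⊕ t * exponent u n
scale-⊕ u n a t = toℕ-injective-mod (begin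
  toℕ (scale u n (a ⊕ t))              ≈⟨ toℕ-mod n (toℕ (a ⊕ t) * e) ⟩
  toℕ (a ⊕ t) * e                      ≈⟨ mod-*ʳ e (toℕ-⊕ a t) ⟩
  (toℕ a + t) * e                      ≡⟨ ℕP.*-distribʳ-+ e (toℕ a) t ⟩
  toℕ a * e + t * e                    ≈⟨ mod-+ʳ (t * e) (toℕ-mod n (toℕ a * e)) ⟨
  toℕ (scale u n a) + t * e            ≈⟨ toℕ-⊕ (scale u n a) (t * e) ⟨
  toℕ (scale u n a ⊕ t * e)            ∎)
  where open mod-Reasoning n
        e = exponent u n

proj-⊕ : ∀ n n' → suc n ℕD.∣ suc n' → ∀ (a : Fin (suc n')) t → proj n (a ⊕ t) ≡ proj n a ⊕ t
proj-⊕ n n' n∣n' a t = toℕ-injective-mod (begin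
  toℕ (proj n (a ⊕ t))     ≈⟨ toℕ-mod n (toℕ (a ⊕ t)) ⟩
  toℕ (a ⊕ t)              ≈⟨ mod-weaken n∣n' (toℕ-⊕ a t) ⟩
  toℕ a + t                ≈⟨ mod-+ʳ t (toℕ-mod n (toℕ a)) ⟨
  toℕ (proj n a) + t       ≈⟨ toℕ-⊕ (proj n a) t ⟨
  toℕ (proj n a ⊕ t)       ∎)
  where open mod-Reasoning n

proj-scale : ∀ u → IsẐ u → ∀ n n' → suc n ℕD.∣ suc n' → ∀ (a : Fin (suc n')) →
  proj n (scale u n' a) ≡ scale u n (proj n a)
proj-scale u isẐ n n' n∣n' a = toℕ-injective-mod (begin
  toℕ (proj n (scale u n' a))          ≈⟨ toℕ-mod n (toℕ (scale u n' a)) ⟩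
  toℕ (scale u n' a)                   ≈⟨ mod-weaken n∣n' (toℕ-mod n' (toℕ a * exponent u n')) ⟩
  toℕ a * exponent u n'                ≈⟨ mod-*ˡ (toℕ a) (exponent-compatible u isẐ n n' n∣n') ⟩
  toℕ a * exponent u n                 ≈⟨ mod-*ʳ (exponent u n) (toℕ-mod n (toℕ a)) ⟨
  toℕ (proj n a) * exponent u n        ≈⟨ toℕ-mod n (toℕ (proj n a) * exponent u n) ⟨
  toℕ (scale u n (proj n a))           ∎)
  where open mod-Reasoning n

act≡push₂ : ∀ u c n b₁ b₂ m → act u c n b₁ b₂ m ≡ push₂ (scale u n) (λ a₁ a₂ → c n a₁ a₂ m) b₁ b₂
act≡push₂ u c n b₁ b₂ m = push≡push₂ (scale u n) (λ a₁ a₂ → c n a₁ a₂ m) b₁ b₂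

act-≋ : ∀ u (c c' : Raw) n m m' {M} → (∀ a₁ a₂ → c n a₁ a₂ m ≋[ M ] c' n a₁ a₂ m') →
  ∀ b₁ b₂ → act u c n b₁ b₂ m ≋[ M ] act u c' n b₁ b₂ m'
act-≋ u c c' n m m' {M} c≋c' b₁ b₂ = begin
  act u c n b₁ b₂ m                                  ≡⟨ act≡push₂ u c n b₁ b₂ m ⟩
  push₂ (scale u n) (λ a₁ a₂ → c n a₁ a₂ m) b₁ b₂    ≈⟨ push₂-≋ (scale u n) c≋c' b₁ b₂ ⟩
  push₂ (scale u n) (λ a₁ a₂ → c' n a₁ a₂ m') b₁ b₂  ≡⟨ act≡push₂ u c' n b₁ b₂ m' ⟨
  act u c' n b₁ b₂ m'                                ∎
  where open ≋-Reasoning M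

module _ (u : RawẐ) (isẐ : IsẐ u) (l : Raw) (isΛ : IsΛ l) where

  act-coefficients-≋ : ∀ n b₁ b₂ m m' → suc m ℕD.∣ suc m' →
    act u l n b₁ b₂ m' ≋[ suc m ] act u l n b₁ b₂ m
  act-coefficients-≋ n b₁ b₂ m m' m∣m' =
    act-≋ u l l n m' m (λ a₁ a₂ → Cong⇒≋ (proj₁ isΛ n a₁ a₂ m m' m∣m')) b₁ b₂

  act-levels-≋ : ∀ n n' → suc n ℕD.∣ suc n' → ∀ b₁ b₂ m →
    push₂ (proj n) (λ a₁ a₂ → act u l n' a₁ a₂ m) b₁ b₂ ≋[ suc m ] act u l n b₁ b₂ m
  act-levels-≋ n n' n∣n' b₁ b₂ m = begin
    push₂ (proj n) (λ a₁ a₂ → act u l n' a₁ a₂ m) b₁ b₂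
      ≡⟨ push₂-cong (proj n) (λ a₁ a₂ → act≡push₂ u l n' a₁ a₂ m) b₁ b₂ ⟩
    push₂ (proj n) (push₂ (scale u n') l') b₁ b₂
      ≡⟨ push₂-∘ (proj n) (scale u n') l' b₁ b₂ ⟩
    push₂ (λ a → proj n (scale u n' a)) l' b₁ b₂
      ≡⟨ push₂-congˡ (proj-scale u isẐ n n' n∣n') l' b₁ b₂ ⟩
    push₂ (λ a → scale u n (proj n a)) l' b₁ b₂
      ≡⟨ push₂-∘ (scale u n) (proj n) l' b₁ b₂ ⟨
    push₂ (scale u n) (push₂ (proj n) l') b₁ b₂
      ≈⟨ push₂-≋ (scale u n) {f = push₂ (proj n) l'} (λ c₁ c₂ → compatible c₁ c₂) b₁ b₂ ⟩
    push₂ (scale u n) (λ c₁ c₂ → l n c₁ c₂ m) b₁ b₂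
      ≡⟨ act≡push₂ u l n b₁ b₂ m ⟨
    act u l n b₁ b₂ m
      ∎
    where
    open ≋-Reasoning (suc m)
    l' : Fin (suc n') → Fin (suc n') → ℤ
    l' a₁ a₂ = l n' a₁ a₂ m
    compatible : ∀ c₁ c₂ → push₂ (proj n) l' c₁ c₂ ≋[ suc m ] l n c₁ c₂ m
    compatible c₁ c₂ = ≋-trans (≡⇒≋ (sym (push≡push₂ (proj n) l' c₁ c₂))) (Cong⇒≋ (proj₂ isΛ n n' n∣n' c₁ c₂ m))

  act-IsΛ : IsΛ (act u l)
  act-IsΛ = (λ n b₁ b₂ m m' m∣m' → ≋⇒Cong (act-coefficients-≋ n b₁ b₂ m m' m∣m'))
          , (λ n n' n∣n' b₁ b₂ m → ≋⇒Cong (≋-trans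
               (≡⇒≋ (push≡push₂ (proj n) (λ a₁ a₂ → act u l n' a₁ a₂ m) b₁ b₂))
               (act-levels-≋ n n' n∣n' b₁ b₂ m)))

act-*Λ-1-pt : ∀ d₁ d₂ u l n b₁ b₂ m →
  act u (l *Λ (1Λ -Λ pt d₁ d₂)) n b₁ b₂ m ≡
  act u l n b₁ b₂ m -ᶻ act u l n (b₁ ⊕ n * d₁ * exponent u n) (b₂ ⊕ n * d₂ * exponent u n) m
act-*Λ-1-pt d₁ d₂ u l n b₁ b₂ m = begin
  act u (l *Λ (1Λ -Λ pt d₁ d₂)) n b₁ b₂ m
    ≡⟨ act≡push₂ u (l *Λ (1Λ -Λ pt d₁ d₂)) n b₁ b₂ m ⟩
  push₂ σ (λ a₁ a₂ → (l *Λ (1Λ -Λ pt d₁ d₂)) n a₁ a₂ m) b₁ b₂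
    ≡⟨ push₂-cong σ (λ a₁ a₂ → *Λ-1-pt l d₁ d₂ n a₁ a₂ m) b₁ b₂ ⟩
  push₂ σ (λ a₁ a₂ → l' a₁ a₂ -ᶻ l' (a₁ ⊖ d₁) (a₂ ⊖ d₂)) b₁ b₂
    ≡⟨ push₂-distrib-- σ l' (λ a₁ a₂ → l' (a₁ ⊖ d₁) (a₂ ⊖ d₂)) b₁ b₂ ⟩
  push₂ σ l' b₁ b₂ -ᶻ push₂ σ (λ a₁ a₂ → l' (a₁ ⊖ d₁) (a₂ ⊖ d₂)) b₁ b₂
    ≡⟨ cong₂ _-ᶻ_ (sym (act≡push₂ u l n b₁ b₂ m))
         (trans (push₂-⊕ σ (n * d₁) (n * d₂) _ _ (λ a → scale-⊕ u n a (n * d₁)) (λ a → scale-⊕ u n a (n * d₂)) l' b₁ b₂)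
                (sym (act≡push₂ u l n (b₁ ⊕ n * d₁ * exponent u n) (b₂ ⊕ n * d₂ * exponent u n) m))) ⟩
  act u l n b₁ b₂ m -ᶻ act u l n (b₁ ⊕ n * d₁ * exponent u n) (b₂ ⊕ n * d₂ * exponent u n) m
    ∎
  where
  open ≡-Reasoning
  σ = scale u n
  l' : Fin (suc n) → Fin (suc n) → ℤ
  l' a₁ a₂ = l n a₁ a₂ m

sumℕ-telescope : ∀ e (H : ℕ → ℤ) → sumℕ e H -ᶻ sumℕ e (λ j → H (suc j)) ≡ H 0 -ᶻ H e
sumℕ-telescope e H = begin
  S -ᶻ S′                         ≡⟨ identity₁ S S′ (H e) ⟩
  (S +ᶻ H e) -ᶻ (S′ +ᶻ H e)       ≡⟨ cong (_-ᶻ (S′ +ᶻ H e)) (sumℕ-last e H) ⟨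
  sumℕ (suc e) H -ᶻ (S′ +ᶻ H e)   ≡⟨ identity₂ (H 0) S′ (H e) ⟩
  H 0 -ᶻ H e                      ∎
  where
  open ≡-Reasoning
  S = sumℕ e H
  S′ = sumℕ e (λ j → H (suc j))
  identity₁ : ∀ a r h → a -ᶻ r ≡ (a +ᶻ h) -ᶻ (r +ᶻ h)
  identity₁ = solve-∀
  identity₂ : ∀ h₀ r h → (h₀ +ᶻ r) -ᶻ (r +ᶻ h) ≡ h₀ -ᶻ h
  identity₂ = solve-∀

sumℕ-≋-mod : ∀ n m (h : ℕ → ℤ) → (∀ j → h (j + suc n) ≡ h j) → ∀ x y → x ≡[ mulLevel n m ] y →
  sumℕ x h ≋[ suc m ] sumℕ y h
sumℕ-≋-mod n m h periodic x y (mk≡ x%≡y%) = begin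
  sumℕ x h                   ≈⟨ reduce x ⟩
  sumℕ (x % suc N') h        ≡⟨ cong (λ z → sumℕ z h) x%≡y% ⟩
  sumℕ (y % suc N') h        ≈⟨ reduce y ⟨
  sumℕ y h                   ∎
  where
  open ≋-Reasoning (suc m)
  N' = mulLevel n m
  reduce : ∀ x → sumℕ x h ≋[ suc m ] sumℕ (x % suc N') h
  reduce x = begin
    sumℕ x h
      ≡⟨ cong (λ z → sumℕ z h) (ℕDM.m≡m%n+[m/n]*n x (suc N')) ⟩
    sumℕ (r + q * suc N') h
      ≡⟨ sumℕ-++ r (q * suc N') h ⟩
    sumℕ r h +ᶻ sumℕ (q * (suc n * suc m)) h′
      ≡⟨ cong (λ z → sumℕ r h +ᶻ sumℕ z h′) (identity q n m) ⟩
    sumℕ r h +ᶻ sumℕ (q * suc m * suc n) h′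
      ≡⟨ cong (sumℕ r h +ᶻ_) (sumℕ-periodic (q * suc m) (suc n) h′ periodic′) ⟩
    sumℕ r h +ᶻ + (q * suc m) *ᶻ X
      ≡⟨ cong (λ z → sumℕ r h +ᶻ z *ᶻ X) (ℤP.pos-* q (suc m)) ⟩
    sumℕ r h +ᶻ + q *ᶻ + suc m *ᶻ X
      ≡⟨ cong (sumℕ r h +ᶻ_) (identityᶻ (+ q) (+ suc m) X) ⟩
    sumℕ r h +ᶻ + suc m *ᶻ (+ q *ᶻ X)
      ≈⟨ ≋-+ (≋-refl {a = sumℕ r h}) (M*x≋0 (+ q *ᶻ X)) ⟩
    sumℕ r h +ᶻ 0ℤ
      ≡⟨ ℤP.+-identityʳ _ ⟩
    sumℕ r h
      ∎
    where
    r = x % suc N'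
    q = x / suc N'
    h′ : ℕ → ℤ
    h′ j = h (r + j)
    X = sumℕ (suc n) h′
    periodic′ : ∀ j → h′ (j + suc n) ≡ h′ j
    periodic′ j = trans (cong h (sym (ℕP.+-assoc r j (suc n)))) (periodic (r + j))
    identity : ∀ q n m → q * (suc n * suc m) ≡ q * suc m * suc n
    identity = ℕSolver.solve-∀
    identityᶻ : ∀ a b c → a *ᶻ b *ᶻ c ≡ b *ᶻ (a *ᶻ c)
    identityᶻ = solve-∀

suc-∣⇒≡[] : ∀ n n' → suc n ℕD.∣ suc n' → n' ≡[ n ] n
suc-∣⇒≡[] n n' n∣n' = mod-cancelʳ-+ 1 (begin
  n' + 1    ≡⟨ ℕP.+-comm n' 1 ⟩
  suc n'    ≈⟨ mk≡ (ℕD.n∣m⇒m%n≡0 (suc n') (suc n) n∣n') ⟩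
  0         ≈⟨ N-mod ⟨
  suc n     ≡⟨ ℕP.+-comm 1 n ⟩
  n + 1     ∎)
  where open mod-Reasoning n

-- The exponent of σ read at level N (m + 1), so that the geometric sum below is compatible in m.
fineExponent : RawẐ → ℕ → ℕ → ℕ
fineExponent u n m = exponent u (mulLevel n m)

-- σ(l (1 - x)) = σ(l) (1 - x^e) = σ(l) (1 + x + ⋯ + x^(e-1)) (1 - x)
cofactor : ℕ → ℕ → RawẐ → Raw → Raw
cofactor d₁ d₂ u l n b₁ b₂ m =
  sumℕ (fineExponent u n m) (λ j → act u l n (b₁ ⊕ j * (n * d₁)) (b₂ ⊕ j * (n * d₂)) m)

module _ (d₁ d₂ : ℕ) (u : RawẐ) (isẐ : IsẐ u) (l : Raw) where

  cofactor-*Λ-1-pt : ∀ n b₁ b₂ m → (cofactor d₁ d₂ u l *Λ (1Λ -Λ pt d₁ d₂)) n b₁ b₂ m ≡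
    act u l n b₁ b₂ m -ᶻ act u l n (b₁ ⊕ fineExponent u n m * (n * d₁)) (b₂ ⊕ fineExponent u n m * (n * d₂)) m
  cofactor-*Λ-1-pt n b₁ b₂ m = begin
    (cofactor d₁ d₂ u l *Λ (1Λ -Λ pt d₁ d₂)) n b₁ b₂ m
      ≡⟨ *Λ-1-pt (cofactor d₁ d₂ u l) d₁ d₂ n b₁ b₂ m ⟩
    sumℕ (e n m) H -ᶻ cofactor d₁ d₂ u l n (b₁ ⊖ d₁) (b₂ ⊖ d₂) m
      ≡⟨ cong (λ z → sumℕ (e n m) H -ᶻ z) (sumℕ-cong (e n m) (λ j →
           cong₂ (λ x y → act u l n x y m) (⊕-assoc b₁ (n * d₁) (j * (n * d₁))) (⊕-assoc b₂ (n * d₂) (j * (n * d₂))))) ⟩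
    sumℕ (e n m) H -ᶻ sumℕ (e n m) (λ j → H (suc j))
      ≡⟨ sumℕ-telescope (e n m) H ⟩
    H 0 -ᶻ H (e n m)
      ≡⟨ cong (_-ᶻ H (e n m)) (cong₂ (λ x y → act u l n x y m) (⊕-identityʳ b₁) (⊕-identityʳ b₂)) ⟩
    act u l n b₁ b₂ m -ᶻ H (e n m)
      ∎
    where
    open ≡-Reasoning
    e = fineExponent u
    H : ℕ → ℤ
    H j = act u l n (b₁ ⊕ j * (n * d₁)) (b₂ ⊕ j * (n * d₂)) m

  act-*Λ-1-pt≈cofactor : act u (l *Λ (1Λ -Λ pt d₁ d₂)) ≈Λ (cofactor d₁ d₂ u l *Λ (1Λ -Λ pt d₁ d₂))
  act-*Λ-1-pt≈cofactor n b₁ b₂ m = ≋⇒Cong (≡⇒≋ (begin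
    act u (l *Λ (1Λ -Λ pt d₁ d₂)) n b₁ b₂ m
      ≡⟨ act-*Λ-1-pt d₁ d₂ u l n b₁ b₂ m ⟩
    act u l n b₁ b₂ m -ᶻ act u l n (b₁ ⊕ n * d₁ * exponent u n) (b₂ ⊕ n * d₂ * exponent u n) m
      ≡⟨ cong (λ z → act u l n b₁ b₂ m -ᶻ z) (cong₂ (λ x y → act u l n x y m) (same-shift b₁ d₁) (same-shift b₂ d₂)) ⟩
    act u l n b₁ b₂ m -ᶻ act u l n (b₁ ⊕ fineExponent u n m * (n * d₁)) (b₂ ⊕ fineExponent u n m * (n * d₂)) m
      ≡⟨ cofactor-*Λ-1-pt n b₁ b₂ m ⟨
    (cofactor d₁ d₂ u l *Λ (1Λ -Λ pt d₁ d₂)) n b₁ b₂ m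
      ∎))
    where
    open ≡-Reasoning
    same-shift : ∀ (b : Fin (suc n)) d → b ⊕ n * d * exponent u n ≡ b ⊕ fineExponent u n m * (n * d)
    same-shift b d = ⊕-congˡ b (mod-trans (≡⇒mod (ℕP.*-comm (n * d) (exponent u n)))
      (mod-*ʳ (n * d) (mod-sym (exponent-compatible u isẐ n (mulLevel n m) (N∣mulLevel n m)))))

  module _ (isΛ : IsΛ l) where

    private
      shifted : ∀ n → ℕ → (b₁ b₂ : Fin (suc n)) → ℕ → ℤ
      shifted n m b₁ b₂ j = act u l n (b₁ ⊕ j * (n * d₁)) (b₂ ⊕ j * (n * d₂)) m

      shifted-periodic : ∀ n m b₁ b₂ j → shifted n m b₁ b₂ (j + suc n) ≡ shifted n m b₁ b₂ j
      shifted-periodic n m b₁ b₂ j = cong₂ (λ x y → act u l n x y m) (period b₁ d₁) (period b₂ d₂)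
        where period : ∀ (b : Fin (suc n)) d → b ⊕ (j + suc n) * (n * d) ≡ b ⊕ j * (n * d)
              period b d = ⊕-congˡ b (mod-trans (≡⇒mod (ℕP.*-distribʳ-+ (n * d) j (suc n))) (+-N*-mod _ (n * d)))

    cofactor-IsΛ : IsΛ (cofactor d₁ d₂ u l)
    cofactor-IsΛ = (λ n b₁ b₂ m m' m∣m' → ≋⇒Cong (coefficients n b₁ b₂ m m' m∣m'))
                 , (λ n n' n∣n' b₁ b₂ m → ≋⇒Cong (levels n n' n∣n' b₁ b₂ m))
      where
      coefficients : ∀ n b₁ b₂ m m' → suc m ℕD.∣ suc m' →
        cofactor d₁ d₂ u l n b₁ b₂ m' ≋[ suc m ] cofactor d₁ d₂ u l n b₁ b₂ m
      coefficients n b₁ b₂ m m' m∣m' = begin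
        sumℕ (fineExponent u n m') (shifted n m' b₁ b₂)
          ≈⟨ sumℕ-≋ (fineExponent u n m') {f = shifted n m' b₁ b₂} {shifted n m b₁ b₂}
               (λ j → act-coefficients-≋ u isẐ l isΛ n (b₁ ⊕ j * (n * d₁)) (b₂ ⊕ j * (n * d₂)) m m' m∣m') ⟩
        sumℕ (fineExponent u n m') (shifted n m b₁ b₂)
          ≈⟨ sumℕ-≋-mod n m (shifted n m b₁ b₂) (shifted-periodic n m b₁ b₂) _ _
               (exponent-compatible u isẐ (mulLevel n m) (mulLevel n m') (ℕD.*-monoʳ-∣ (suc n) m∣m')) ⟩
        sumℕ (fineExponent u n m) (shifted n m b₁ b₂)
          ∎
        where open ≋-Reasoning (suc m)
      levels : ∀ n n' → suc n ℕD.∣ suc n' → ∀ b₁ b₂ m →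
        push (proj n) (λ a₁ a₂ → cofactor d₁ d₂ u l n' a₁ a₂ m) b₁ b₂ ≋[ suc m ] cofactor d₁ d₂ u l n b₁ b₂ m
      levels n n' n∣n' b₁ b₂ m = begin
        push (proj n) (λ a₁ a₂ → sumℕ E' (shifted n' m a₁ a₂)) b₁ b₂
          ≡⟨ push≡push₂ (proj n) (λ a₁ a₂ → sumℕ E' (shifted n' m a₁ a₂)) b₁ b₂ ⟩
        push₂ (proj n) (λ a₁ a₂ → sumℕ E' (shifted n' m a₁ a₂)) b₁ b₂
          ≡⟨ push₂-sumℕ (proj n) E' (λ j a₁ a₂ → shifted n' m a₁ a₂ j) b₁ b₂ ⟩
        sumℕ E' (λ j → push₂ (proj n) (λ a₁ a₂ → shifted n' m a₁ a₂ j) b₁ b₂)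
          ≡⟨ sumℕ-cong E' (λ j → push₂-⊕ (proj n) (j * (n' * d₁)) (j * (n' * d₂)) _ _
               (λ a → proj-⊕ n n' n∣n' a (j * (n' * d₁))) (λ a → proj-⊕ n n' n∣n' a (j * (n' * d₂))) l' b₁ b₂) ⟩
        sumℕ E' (λ j → push₂ (proj n) l' (b₁ ⊕ j * (n' * d₁)) (b₂ ⊕ j * (n' * d₂)))
          ≈⟨ sumℕ-≋ E' (λ j → act-levels-≋ u isẐ l isΛ n n' n∣n' (b₁ ⊕ j * (n' * d₁)) (b₂ ⊕ j * (n' * d₂)) m) ⟩
        sumℕ E' (λ j → act u l n (b₁ ⊕ j * (n' * d₁)) (b₂ ⊕ j * (n' * d₂)) m)
          ≡⟨ sumℕ-cong E' (λ j → cong₂ (λ x y → act u l n x y m) (level-shift j b₁ d₁) (level-shift j b₂ d₂)) ⟩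
        sumℕ E' (shifted n m b₁ b₂)
          ≈⟨ sumℕ-≋-mod n m (shifted n m b₁ b₂) (shifted-periodic n m b₁ b₂) _ _
               (exponent-compatible u isẐ (mulLevel n m) (mulLevel n' m) (ℕD.*-monoˡ-∣ (suc m) n∣n')) ⟩
        sumℕ (fineExponent u n m) (shifted n m b₁ b₂)
          ∎
        where
        open ≋-Reasoning (suc m)
        E' = fineExponent u n' m
        l' : Fin (suc n') → Fin (suc n') → ℤ
        l' a₁ a₂ = act u l n' a₁ a₂ m
        level-shift : ∀ j (b : Fin (suc n)) d → b ⊕ j * (n' * d) ≡ b ⊕ j * (n * d)
        level-shift j b d = ⊕-congˡ b (mod-*ˡ j (mod-*ʳ d (suc-∣⇒≡[] n n' n∣n')))

module _ (u v : RawẐ) (uv≡1 : ∀ m → Cong (suc m) (u m *ᶻ v m) 1ℤ) where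

  exponent-inverse : ∀ n → exponent v n * exponent u n ≡[ n ] 1
  exponent-inverse n = +≋+⇒mod _ _ (begin
    + (exponent v n * exponent u n)   ≡⟨ ℤP.pos-* (exponent v n) (exponent u n) ⟩
    + exponent v n *ᶻ + exponent u n  ≈⟨ ≋-* (%ℕ-≋ (v n) n) (%ℕ-≋ (u n) n) ⟩
    v n *ᶻ u n                        ≡⟨ ℤP.*-comm (v n) (u n) ⟩
    u n *ᶻ v n                        ≈⟨ Cong⇒≋ (uv≡1 n) ⟩
    1ℤ                                ∎)
    where open ≋-Reasoning (suc n)

  scale-inverse : ∀ n (a : Fin (suc n)) → scale u n (scale v n a) ≡ a
  scale-inverse n a = toℕ-injective-mod (begin
    toℕ (scale u n (scale v n a))              ≈⟨ toℕ-mod n (toℕ (scale v n a) * exponent u n) ⟩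
    toℕ (scale v n a) * exponent u n           ≈⟨ mod-*ʳ (exponent u n) (toℕ-mod n (toℕ a * exponent v n)) ⟩
    toℕ a * exponent v n * exponent u n        ≡⟨ ℕP.*-assoc (toℕ a) (exponent v n) (exponent u n) ⟩
    toℕ a * (exponent v n * exponent u n)      ≈⟨ mod-*ˡ (toℕ a) (exponent-inverse n) ⟩
    toℕ a * 1                                  ≡⟨ ℕP.*-identityʳ (toℕ a) ⟩
    toℕ a                                      ∎)
    where open mod-Reasoning n

  act-inverse : ∀ (c : Raw) n b₁ b₂ m → act u (act v c) n b₁ b₂ m ≡ c n b₁ b₂ m
  act-inverse c n b₁ b₂ m = begin
    act u (act v c) n b₁ b₂ m
      ≡⟨ act≡push₂ u (act v c) n b₁ b₂ m ⟩
    push₂ (scale u n) (λ a₁ a₂ → act v c n a₁ a₂ m) b₁ b₂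
      ≡⟨ push₂-cong (scale u n) (λ a₁ a₂ → act≡push₂ v c n a₁ a₂ m) b₁ b₂ ⟩
    push₂ (scale u n) (push₂ (scale v n) c') b₁ b₂
      ≡⟨ push₂-∘ (scale u n) (scale v n) c' b₁ b₂ ⟩
    push₂ (λ a → scale u n (scale v n a)) c' b₁ b₂
      ≡⟨ push₂-id (scale-inverse n) c' b₁ b₂ ⟩
    c n b₁ b₂ m
      ∎
    where
    open ≡-Reasoning
    c' : Fin (suc n) → Fin (suc n) → ℤ
    c' a₁ a₂ = c n a₁ a₂ m

module _ (d₁ d₂ : ℕ) where

  act-Λ[1-pt]⊆Λ[1-pt] : ∀ u → IsẐ u → (l : Raw) → IsΛ l →
    Σ Raw (λ k → IsΛ k × act u (l *Λ (1Λ -Λ pt d₁ d₂)) ≈Λ (k *Λ (1Λ -Λ pt d₁ d₂)))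
  act-Λ[1-pt]⊆Λ[1-pt] u isẐ l isΛ =
    cofactor d₁ d₂ u l , cofactor-IsΛ d₁ d₂ u isẐ l isΛ , act-*Λ-1-pt≈cofactor d₁ d₂ u isẐ l

  Λ[1-pt]⊆act-Λ[1-pt] : ∀ u → IsUnitẐ u → (k : Raw) → IsΛ k →
    Σ Raw (λ l → IsΛ l × act u (l *Λ (1Λ -Λ pt d₁ d₂)) ≈Λ (k *Λ (1Λ -Λ pt d₁ d₂)))
  Λ[1-pt]⊆act-Λ[1-pt] u (_ , v , isẐv , uv≡1) k isΛ = l , isΛl , λ n b₁ b₂ m → ≋⇒Cong (≋-trans
    (act-≋ u (l *Λ (1Λ -Λ pt d₁ d₂)) (act v (k *Λ (1Λ -Λ pt d₁ d₂))) n m m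
       (λ a₁ a₂ → ≋-sym (Cong⇒≋ (v[k·[1-x]]≈l·[1-x] n a₁ a₂ m))) b₁ b₂)
    (≡⇒≋ (act-inverse u v uv≡1 (k *Λ (1Λ -Λ pt d₁ d₂)) n b₁ b₂ m)))
    where
    l : Raw
    l = cofactor d₁ d₂ v k
    isΛl : IsΛ l
    isΛl = cofactor-IsΛ d₁ d₂ v isẐv k isΛ
    v[k·[1-x]]≈l·[1-x] : act v (k *Λ (1Λ -Λ pt d₁ d₂)) ≈Λ (l *Λ (1Λ -Λ pt d₁ d₂))
    v[k·[1-x]]≈l·[1-x] = act-*Λ-1-pt≈cofactor d₁ d₂ v isẐv k

  Λ[1-pt]-act-stable : ∀ u → IsUnitẐ u →
    ((l : Raw) → IsΛ l → Σ Raw (λ k → IsΛ k × act u (l *Λ (1Λ -Λ pt d₁ d₂)) ≈Λ (k *Λ (1Λ -Λ pt d₁ d₂))))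
    × ((k : Raw) → IsΛ k → Σ Raw (λ l → IsΛ l × act u (l *Λ (1Λ -Λ pt d₁ d₂)) ≈Λ (k *Λ (1Λ -Λ pt d₁ d₂))))
  Λ[1-pt]-act-stable u isUnit = act-Λ[1-pt]⊆Λ[1-pt] u (proj₁ isUnit) , Λ[1-pt]⊆act-Λ[1-pt] u isUnit

lemma3p11 : (w : Which) →
    ((l : Raw) → IsΛ l → (l *Λ (1Λ -Λ elt w)) ≈Λ 0Λ → l ≈Λ 0Λ)
    × ((u : RawẐ) → IsUnitẐ u →
        ((l : Raw) → IsΛ l → Σ Raw (λ k → IsΛ k
            × act u (l *Λ (1Λ -Λ elt w)) ≈Λ (k *Λ (1Λ -Λ elt w))))
        × ((k : Raw) → IsΛ k → Σ Raw (λ l → IsΛ l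
            × act u (l *Λ (1Λ -Λ elt w)) ≈Λ (k *Λ (1Λ -Λ elt w)))))
lemma3p11 isξ  = 1-ξηᵈ-non-zero-divisor 0 , Λ[1-pt]-act-stable 1 0
lemma3p11 isη  = 1-η-non-zero-divisor     , Λ[1-pt]-act-stable 0 1
lemma3p11 isξη = 1-ξηᵈ-non-zero-divisor 1 , Λ[1-pt]-act-stable 1 1
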